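{- Let $G=(V,E)$ be an undirected graph with edge weights $w:E\to\{0,1,\dots,W\}$, let $r$ be a VC-SNDP requirement function with maximum requirement $k$, and let $t\ge1$ be an integer. Let $H$ be the output of the streaming greedy vertex-fault-tolerant spanner algorithm (described in the context) run on the edges of $G$ in an arbitrary order with parameters $t$, $f=(2t-2)(2k-1)$ and $\epsilon=1/(2t-1)$. Then the optimal value of the linear program VC-SNDP-LP on $(H,w,h)$ is at most $4t$ times the minimum weight of a feasible (integral) solution of the VC-SNDP instance $(G,r)$.
   Context: VC-SNDP: given $G=(V,E)$ with nonnegative edge weights and integers $r(uv)\ge0$ for unordered pairs, find a minimum-weight subgraph in which every pair $u,v$ has $r(uv)$ internally vertex-disjoint paths; we assume the instance on $G$ is feasible. A biset is a pair $\hat S=(S,S^+)$ with $S\subseteq S^+\subseteq V$. Define $h(\hat S)=\max\bigl(0,\max_{v\in S,\,u\in V\setminus S^+} r(u,v)-|S^+\setminus S|\bigr)$. For a graph $(V,E')$, VC-SNDP-LP$(E',w,h)$ is: minimize $\sum_{e\in E'} w(e)x(e)$ subject to $\sum_{uv\in E':\,u\in S,\,v\in V\setminus S^+} x(uv)\ge h(\hat S)$ for all bisets $\hat S=(S,S^+)$, and $x(e)\ge0$ for all $e\in E'$. Streaming greedy VFT spanner algorithm with parameters $(t,f,\epsilon)$: buckets $B_0=\{0\}$, $B_i=[(1+\epsilon)^{i-1},(1+\epsilon)^i)$ for $i=1,\dots,T$ covering $\{1,\dots,W\}$; start with $H_i=(V,\emptyset)$; for each arriving edge $(u,v)$ with $w(u,v)\in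 B_j$, add it to $H_j$ if there is a set $F\subseteq V\setminus\{u,v\}$ with $|F|\le f$ such that the unweighted (hop) distance between $u$ and $v$ in the subgraph of $H_j$ induced on $V\setminus F$ exceeds $2t-1$; output $H=\bigcup_i H_i$. -}

module Defs where

open import Data.Nat as ℕ using (ℕ; zero; suc; _∸_; _⊔_)
open import Data.Integer using (+_)
open import Data.Rational as ℚ using (ℚ; 0ℚ; 1ℚ; _/_)
open import Data.Fin using (Fin)
open import Data.Fin.Subset using (Subset; _∈_; _∉_; _─_; ∣_∣)
open import Data.Bool using (Bool; true; false; _∧_; _∨_; not; if_then_else_)
open import Data.Vec using (lookup)
open import Data.List using (List; []; _∷_; length; filter; foldr; allFin; map)
open import Data.List.Membership.Propositional using () renaming (_∈_ to _∈ˡ_)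
open import Data.List.Relation.Unary.All using (All)
open import Data.List.Relation.Unary.Unique.Propositional using (Unique)
open import Data.List.Relation.Unary.AllPairs using (AllPairs)
open import Data.Product using (Σ; _×_; _,_; ∃; proj₁; proj₂)
open import Data.Sum using (_⊎_)
open import Data.Empty using (⊥)
open import Relation.Nullary using (¬_)
open import Relation.Binary.PropositionalEquality using (_≡_; _≢_)

-- Weighted graphs on the vertex set V = Fin n.
-- An (undirected) edge {u,v} with weight w; the orientation of the
-- record is irrelevant everywhere below.

record Edge (n : ℕ) : Set where
  constructor edge
  field
    eu : Fin n
    ev : Fin n
    wt : ℕ
open Edge public

SameEnds : ∀ {n} → Edge n → Edge n → Set
SameEnds e e' = (eu e ≡ eu e' × ev e ≡ ev e') ⊎ (eu e ≡ ev e' × ev e ≡ eu e')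

-- a simple undirected graph given as a list of edges (the list order is
-- the order in which the stream presents the edges)
SimpleGraph : ∀ {n} → List (Edge n) → Set
SimpleGraph es = All (λ e → eu e ≢ ev e) es × AllPairs (λ e e' → ¬ SameEnds e e') es

Adj : ∀ {n} → List (Edge n) → Fin n → Fin n → Set
Adj E a b = Σ _ λ e → (e ∈ˡ E) × ((eu e ≡ a × ev e ≡ b) ⊎ (eu e ≡ b × ev e ≡ a))

data Walk {n} (E : List (Edge n)) : Fin n → Fin n → Set where
  [] : ∀ {a} → Walk E a a
  _∷_ : ∀ {a b c} → Adj E a b → Walk E b c → Walk E a c

verts : ∀ {n} {E : List (Edge n)} {a b} → Walk E a b → List (Fin n)
verts {a = a} [] = a ∷ []
verts {a = a} (_ ∷ w) = a ∷ verts w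

inner : ∀ {n} {E : List (Edge n)} {a b} → Walk E a b → List (Fin n)
inner [] = []
inner (_ ∷ []) = []
inner (_∷_ {b = b} _ (p ∷ w)) = b ∷ inner (p ∷ w)

hops : ∀ {n} {E : List (Edge n)} {a b} → Walk E a b → ℕ
hops [] = 0
hops (_ ∷ w) = suc (hops w)

IsPath : ∀ {n} {E : List (Edge n)} {a b} → Walk E a b → Set
IsPath w = Unique (verts w)

Disjoint : ∀ {n} → List (Fin n) → List (Fin n) → Set
Disjoint xs ys = ∀ {x} → x ∈ˡ xs → x ∈ˡ ys → ⊥

HasDisjointPaths : ∀ {n} → List (Edge n) → Fin n → Fin n → ℕ → Set
HasDisjointPaths E u v k =
  Σ (Fin k → Walk E u v) λ P →
    (∀ i → IsPath (P i)) ×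
    (∀ i j → i ≢ j → verts (P i) ≢ verts (P j) × Disjoint (inner (P i)) (inner (P j)))

-- requirement functions: r u v for u ≠ v (r u u is irrelevant)
Req : ℕ → Set
Req n = Fin n → Fin n → ℕ

Symmetric : ∀ {n} → Req n → Set
Symmetric r = ∀ u v → r u v ≡ r v u

Satisfies : ∀ {n} → Req n → List (Edge n) → Set
Satisfies r E = ∀ u v → u ≢ v → HasDisjointPaths E u v (r u v)

maxReq : ∀ {n} → Req n → ℕ
maxReq {n} r = foldr _⊔_ 0 (map (λ u → foldr _⊔_ 0 (map (λ v → r u v) (allFin n))) (allFin n))

totalWeight : ∀ {n} → List (Edge n) → ℕ
totalWeight E = foldr (λ e s → wt e ℕ.+ s) 0 E

ℕtoℚ : ℕ → ℚ
ℕtoℚ m = + m / 1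

_^ℚ_ : ℚ → ℕ → ℚ
q ^ℚ zero = 1ℚ
q ^ℚ suc m = q ℚ.* (q ^ℚ m)

-- ε = 1/(2t-1)  (t ≥ 1 is assumed in the theorem; eps 0 is a dummy)
eps : ℕ → ℚ
eps zero = 0ℚ
eps (suc s) = + 1 / suc (2 ℕ.* s)

InBucket : ℚ → ℕ → ℕ → Set
InBucket ε zero w = w ≡ 0
InBucket ε (suc i) w =
  ((1ℚ ℚ.+ ε) ^ℚ i) ℚ.≤ ℕtoℚ w × ℕtoℚ w ℚ.< ((1ℚ ℚ.+ ε) ^ℚ suc i)

-- The streaming greedy VFT spanner algorithm.
-- State: the list of edges added so far, each tagged with its bucket index j.

State : ℕ → Set
State n = List (ℕ × Edge n)

bucketGraph : ∀ {n} → State n → ℕ → List (Edge n)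
bucketGraph [] j = []
bucketGraph ((i , e) ∷ st) j with i ℕ.≟ j
... | Relation.Nullary.yes _ = e ∷ bucketGraph st j
... | Relation.Nullary.no _ = bucketGraph st j

output : ∀ {n} → State n → List (Edge n)
output st = map proj₂ st

FarAfterFaults : ∀ {n} → (t f : ℕ) → List (Edge n) → Fin n → Fin n → Set
FarAfterFaults {n} t f Hj u v =
  Σ (Subset n) λ F → u ∉ F × v ∉ F × ∣ F ∣ ℕ.≤ f ×
    ¬ (Σ (Walk Hj u v) λ p → All (λ x → x ∉ F) (verts p) × hops p ℕ.≤ (2 ℕ.* t ∸ 1))

data Run {n} (t f : ℕ) (ε : ℚ) : State n → List (Edge n) → State n → Set where
  done : ∀ {st} → Run t f ε st [] st
  keep : ∀ {st e es st'} j → InBucket ε j (wt e) →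
         FarAfterFaults t f (bucketGraph st j) (eu e) (ev e) →
         Run t f ε ((j , e) ∷ st) es st' → Run t f ε st (e ∷ es) st'
  skip : ∀ {st e es st'} j → InBucket ε j (wt e) →
         ¬ FarAfterFaults t f (bucketGraph st j) (eu e) (ev e) →
         Run t f ε st es st' → Run t f ε st (e ∷ es) st'

hBiset : ∀ {n} → Req n → Subset n → Subset n → ℕ
hBiset {n} r S S⁺ =
  foldr _⊔_ 0 (map (λ v → foldr _⊔_ 0 (map (λ u →
      if lookup S v ∧ not (lookup S⁺ u) then r u v else 0) (allFin n))) (allFin n))
  ∸ ∣ S⁺ ─ S ∣

crosses : ∀ {n} → Subset n → Subset n → Edge n → Bool
crosses S S⁺ e = (lookup S (eu e) ∧ not (lookup S⁺ (ev e)))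
               ∨ (lookup S (ev e) ∧ not (lookup S⁺ (eu e)))

sumℚ : ∀ {n} → (Edge n → ℚ) → List (Edge n) → ℚ
sumℚ g E = foldr (λ e s → g e ℚ.+ s) 0ℚ E

LPFeasible : ∀ {n} → Req n → List (Edge n) → (Edge n → ℚ) → Set
LPFeasible {n} r E' x =
  All (λ e → 0ℚ ℚ.≤ x e) E' ×
  (∀ (S S⁺ : Subset n) → S Data.Fin.Subset.⊆ S⁺ →
     ℕtoℚ (hBiset r S S⁺) ℚ.≤ sumℚ (λ e → if crosses S S⁺ e then x e else 0ℚ) E')

lpCost : ∀ {n} → List (Edge n) → (Edge n → ℚ) → ℚ
lpCost E' x = sumℚ (λ e → ℕtoℚ (wt e) ℚ.* x e) E'

subEdges : ∀ {n} → (Edge n → Bool) → List (Edge n) → List (Edge n)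
subEdges p [] = []
subEdges p (e ∷ E) = if p e then e ∷ subEdges p E else subEdges p E

module Submission where

-- Charge every edge e of an optimal solution O to edges of H: if the greedy algorithm kept e, charge
-- it k times to itself; otherwise, when e was rejected, no set of f faults separated its ends by more
-- than 2t - 1 hops in its weight bucket, so faulting the interiors of the walks found so far yields
-- 2k - 1 short walks with pairwise disjoint interiors, each of weight at most 2t w(e).  Dividing by k,
-- the charges cost at most 4t w(O).  For a biset (S, S⁺) with |S⁺ - S| < k crossed by e, at most
-- k - 1 of those walks pass through S⁺ - S, so at least k of them contain an edge crossing (S, S⁺);
-- since O contains r(u, v) internally disjoint u–v paths, each passing through S⁺ - S or using a
-- crossing edge of O, the charges cover every biset constraint.

open import Defs
open import Data.Nat using (ℕ; _≤_; _*_; _∸_; suc)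
open import Data.Rational using (ℚ) renaming (_≤_ to _≤ℚ_; _*_ to _*ℚ_)
open import Data.Bool using (Bool)
open import Data.List using (List; [])
open import Data.List.Relation.Unary.All using (All)
open import Data.Product using (Σ; _×_)

open import Data.Nat using (zero; _+_; _<_; _⊔_; z≤n; s≤s; _≤?_; NonZero)
open import Data.Nat.Properties
open import Data.Nat.Tactic.RingSolver using (solve-∀)
open import Data.Integer as ℤ using () renaming (+_ to pos)
import Data.Integer.Properties as ℤ
import Data.Integer.Tactic.RingSolver as ℤ-Solver
open import Data.Rational as ℚ using (0ℚ; 1ℚ)
import Data.Rational.Properties as ℚ
open import Data.Rational.Unnormalised as ℚᵘ using (ℚᵘ; mkℚᵘ; *≡*; *≤*)
import Data.Rational.Unnormalised.Properties as ℚᵘ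
open import Data.Fin as Fin using (Fin)
import Data.Fin.Properties as Fin
open import Data.Fin.Subset
  using (Subset; ⊥; ⁅_⁆; _∪_; ∣_∣; _─_) renaming (_∈_ to _∈ₛ_; _∉_ to _∉ₛ_)
open import Data.Fin.Subset.Properties
  using (x∈p∪q⁻; x∈p∪q⁺; x∈⁅y⁆⇒x≡y; x∈⁅x⁆; ∉⊥; ∣⊥∣≡0; ∣⁅x⁆∣≡1; _∈?_)
open import Data.Vec as Vec using (lookup)
open import Data.Vec.Properties using ([]=⇒lookup; lookup⇒[]=)
open import Data.Bool using (true; false; _∧_; not; if_then_else_; T)
open import Data.Unit using (tt)
open import Data.Bool.Properties using (∧-zeroʳ; ∧-identityʳ; ∨-zeroʳ)
open import Data.List using (_∷_; length; _++_; map; concatMap; foldr; allFin; filter; filterᵇ; tabulate)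
open import Data.List.Properties
  using (length-++; length-map; length-tabulate; length-filter; length-removeAt′; foldr-preservesᵇ; foldr-preservesᵒ)
open import Data.List.Membership.Propositional using (_∈_; find; lose)
open import Data.List.Membership.Propositional.Properties
  using (∈-map⁺; ∈-++⁺ˡ; ∈-++⁺ʳ; ∈-++⁻; ∈-allFin; ∈-filter⁺; ∈-filter⁻)
open import Data.List.Relation.Unary.Any as Any using (Any; here; there; any?)
import Data.List.Relation.Unary.Any.Properties as Any
open import Data.List.Relation.Unary.All as All using ([]; _∷_)
import Data.List.Relation.Unary.All.Properties as All
open import Data.List.Relation.Unary.AllPairs as AllPairs using (AllPairs; []; _∷_)
import Data.List.Relation.Unary.AllPairs.Properties as AllPairs
open import Data.List.Relation.Unary.Unique.Propositional using (Unique)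
open import Data.Product using (_,_; proj₁; proj₂; ∃-syntax)
open import Data.Sum using (_⊎_; inj₁; inj₂; swap) renaming (map to map-⊎)
open import Data.Empty using (⊥-elim) renaming (⊥ to Empty)
open import Relation.Binary.Definitions using (DecidableEquality)
open import Relation.Nullary using (¬_; ¬?; Dec; yes; no; does)
open import Relation.Nullary.Decidable using (_×-dec_; _⊎-dec_; T?)
open import Relation.Binary.PropositionalEquality
open import Function using (_∘_; _∋_)

module _ {A : Set} where

  sumBy : (A → ℕ) → List A → ℕ
  sumBy f [] = 0
  sumBy f (x ∷ xs) = f x + sumBy f xs

  countᵇ : (A → Bool) → List A → ℕ
  countᵇ p = sumBy (λ x → if p x then 1 else 0)

  sumBy-++ : ∀ f xs ys → sumBy f (xs ++ ys) ≡ sumBy f xs + sumBy f ys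
  sumBy-++ f [] ys = refl
  sumBy-++ f (x ∷ xs) ys = trans (cong (f x +_) (sumBy-++ f xs ys)) (sym (+-assoc (f x) _ _))

  sumBy-mono : ∀ {f g} xs → (∀ {x} → x ∈ xs → f x ≤ g x) → sumBy f xs ≤ sumBy g xs
  sumBy-mono [] h = z≤n
  sumBy-mono (x ∷ xs) h = +-mono-≤ (h (here refl)) (sumBy-mono xs (h ∘ there))

  sumBy-cong : ∀ {f g} xs → (∀ x → f x ≡ g x) → sumBy f xs ≡ sumBy g xs
  sumBy-cong [] h = refl
  sumBy-cong (x ∷ xs) h = cong₂ _+_ (h x) (sumBy-cong xs h)

  sumBy-const : ∀ c xs → sumBy (λ _ → c) xs ≡ length xs * c
  sumBy-const c [] = refl
  sumBy-const c (x ∷ xs) = cong (c +_) (sumBy-const c xs)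

  sumBy-+ : ∀ f g xs → sumBy (λ x → f x + g x) xs ≡ sumBy f xs + sumBy g xs
  sumBy-+ f g [] = refl
  sumBy-+ f g (x ∷ xs) = trans (cong (f x + g x +_) (sumBy-+ f g xs))
    (interchange (f x) (g x) (sumBy f xs) (sumBy g xs))
    where
    interchange : ∀ a b c d → (a + b) + (c + d) ≡ (a + c) + (b + d)
    interchange = solve-∀

  *-distribˡ-sumBy : ∀ c f xs → c * sumBy f xs ≡ sumBy (λ x → c * f x) xs
  *-distribˡ-sumBy c f [] = *-zeroʳ c
  *-distribˡ-sumBy c f (x ∷ xs) =
    trans (*-distribˡ-+ c (f x) (sumBy f xs)) (cong (c * f x +_) (*-distribˡ-sumBy c f xs))

  length-filterᵇ : ∀ p xs → length (filterᵇ p xs) ≡ countᵇ p xs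
  length-filterᵇ p [] = refl
  length-filterᵇ p (x ∷ xs) with p x
  ... | true = cong suc (length-filterᵇ p xs)
  ... | false = length-filterᵇ p xs

  countᵇ-∈ : ∀ p {x} xs → x ∈ xs → p x ≡ true → 1 ≤ countᵇ p xs
  countᵇ-∈ p (x ∷ xs) (here refl) px rewrite px = s≤s z≤n
  countᵇ-∈ p (y ∷ xs) (there x∈xs) px = ≤-trans (countᵇ-∈ p xs x∈xs px) (m≤n+m _ _)

sumBy-concatMap : ∀ {A B : Set} (g : B → ℕ) (f : A → List B) xs →
  sumBy g (concatMap f xs) ≡ sumBy (sumBy g ∘ f) xs
sumBy-concatMap g f [] = refl
sumBy-concatMap g f (x ∷ xs) = trans (sumBy-++ g (f x) (concatMap f xs)) (cong (sumBy g (f x) +_) (sumBy-concatMap g f xs))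

sumBy-swap : ∀ {A B : Set} (f : A → B → ℕ) xs ys →
  sumBy (λ x → sumBy (f x) ys) xs ≡ sumBy (λ y → sumBy (λ x → f x y) xs) ys
sumBy-swap f [] ys = sym (sumBy-zero ys)
  where
  sumBy-zero : ∀ ys → sumBy (λ _ → 0) ys ≡ 0
  sumBy-zero [] = refl
  sumBy-zero (_ ∷ ys) = sumBy-zero ys
sumBy-swap f (x ∷ xs) ys = trans (cong (sumBy (f x) ys +_) (sumBy-swap f xs ys))
  (sym (sumBy-+ (f x) (λ y → sumBy (λ x′ → f x′ y) xs) ys))

module _ {A : Set} (g : A → ℕ) where

  max-attained : ∀ xs → foldr _⊔_ 0 (map g xs) ≡ 0 ⊎ ∃[ x ] foldr _⊔_ 0 (map g xs) ≡ g x
  max-attained xs = foldr-preservesᵇ {P = Attained} ⊔-attained (inj₁ refl)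
    (All.map⁺ (All.universal (λ x → inj₂ (x , refl)) xs))
    where
    Attained : ℕ → Set
    Attained z = z ≡ 0 ⊎ ∃[ x ] z ≡ g x
    ⊔-attained : ∀ {a b} → Attained a → Attained b → Attained (a ⊔ b)
    ⊔-attained {a} {b} pa pb with ⊔-sel a b
    ... | inj₁ eq = subst Attained (sym eq) pa
    ... | inj₂ eq = subst Attained (sym eq) pb

  ≤max : ∀ {x} xs → x ∈ xs → g x ≤ foldr _⊔_ 0 (map g xs)
  ≤max {x} xs x∈xs =
    foldr-preservesᵒ {P = g x ≤_} ⊔-bound 0 (map g xs) (inj₂ (Any.map⁺ (Any.map (λ { refl → ≤-refl }) x∈xs)))
    where
    ⊔-bound : ∀ a b → g x ≤ a ⊎ g x ≤ b → g x ≤ a ⊔ b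
    ⊔-bound a b (inj₁ ≤a) = m≤n⇒m≤n⊔o b ≤a
    ⊔-bound a b (inj₂ ≤b) = m≤n⇒m≤o⊔n a ≤b

module _ {A : Set} where

  ∈-─⁺ : ∀ {x y : A} {xs} (x∈xs : x ∈ xs) → y ∈ xs → y ≢ x → y ∈ (xs Any.─ x∈xs)
  ∈-─⁺ (here refl) (here refl) y≢x = ⊥-elim (y≢x refl)
  ∈-─⁺ (here refl) (there y∈xs) _ = y∈xs
  ∈-─⁺ (there x∈xs) (here refl) _ = here refl
  ∈-─⁺ (there x∈xs) (there y∈xs) y≢x = there (∈-─⁺ x∈xs y∈xs y≢x)

  unique⊆⇒length≤ : ∀ xs ys → Unique xs → All (_∈ ys) xs → length xs ≤ length ys
  unique⊆⇒length≤ [] ys _ _ = z≤n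
  unique⊆⇒length≤ (x ∷ xs) ys (x∉xs ∷ uniq) (x∈ys ∷ xs⊆ys) =
    subst (suc (length xs) ≤_) (sym (length-removeAt′ ys (Any.index x∈ys)))
      (s≤s (unique⊆⇒length≤ xs (ys Any.─ x∈ys) uniq (still-in xs x∉xs xs⊆ys)))
    where
    still-in : ∀ zs → All (x ≢_) zs → All (_∈ ys) zs → All (_∈ (ys Any.─ x∈ys)) zs
    still-in [] _ _ = []
    still-in (z ∷ zs) (x≢z ∷ x≢zs) (z∈ys ∷ zs⊆ys) =
      ∈-─⁺ x∈ys z∈ys (x≢z ∘ sym) ∷ still-in zs x≢zs zs⊆ys

∣p∪q∣≤∣p∣+∣q∣ : ∀ {n} (p q : Subset n) → ∣ p ∪ q ∣ ≤ ∣ p ∣ + ∣ q ∣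
∣p∪q∣≤∣p∣+∣q∣ Vec.[] Vec.[] = z≤n
∣p∪q∣≤∣p∣+∣q∣ (true Vec.∷ p) (true Vec.∷ q) =
  s≤s (≤-trans (∣p∪q∣≤∣p∣+∣q∣ p q) (+-monoʳ-≤ ∣ p ∣ (n≤1+n _)))
∣p∪q∣≤∣p∣+∣q∣ (true Vec.∷ p) (false Vec.∷ q) = s≤s (∣p∪q∣≤∣p∣+∣q∣ p q)
∣p∪q∣≤∣p∣+∣q∣ (false Vec.∷ p) (true Vec.∷ q) =
  ≤-trans (s≤s (∣p∪q∣≤∣p∣+∣q∣ p q)) (≤-reflexive (sym (+-suc ∣ p ∣ ∣ q ∣)))
∣p∪q∣≤∣p∣+∣q∣ (false Vec.∷ p) (false Vec.∷ q) = ∣p∪q∣≤∣p∣+∣q∣ p q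

module _ {n : ℕ} where

  fromList : List (Fin n) → Subset n
  fromList [] = ⊥
  fromList (x ∷ xs) = ⁅ x ⁆ ∪ fromList xs

  ∣fromList∣≤length : ∀ xs → ∣ fromList xs ∣ ≤ length xs
  ∣fromList∣≤length [] = ≤-reflexive (∣⊥∣≡0 n)
  ∣fromList∣≤length (x ∷ xs) = ≤-trans (∣p∪q∣≤∣p∣+∣q∣ ⁅ x ⁆ (fromList xs))
    (subst (λ k → k + ∣ fromList xs ∣ ≤ suc (length xs)) (sym (∣⁅x⁆∣≡1 x)) (s≤s (∣fromList∣≤length xs)))

  ∈fromList⁺ : ∀ {x} xs → x ∈ xs → x ∈ₛ fromList xs
  ∈fromList⁺ (x ∷ xs) (here refl) = x∈p∪q⁺ (inj₁ (x∈⁅x⁆ x))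
  ∈fromList⁺ (y ∷ xs) (there x∈xs) = x∈p∪q⁺ (inj₂ (∈fromList⁺ xs x∈xs))

  ∈fromList⁻ : ∀ {x} xs → x ∈ₛ fromList xs → x ∈ xs
  ∈fromList⁻ [] x∈⊥ = ⊥-elim (∉⊥ x∈⊥)
  ∈fromList⁻ (y ∷ xs) x∈ with x∈p∪q⁻ ⁅ y ⁆ (fromList xs) x∈
  ... | inj₁ x∈⁅y⁆ = here (x∈⁅y⁆⇒x≡y y x∈⁅y⁆)
  ... | inj₂ x∈rest = there (∈fromList⁻ xs x∈rest)

toList : ∀ {n} → Subset n → List (Fin n)
toList Vec.[] = []
toList (true Vec.∷ p) = Fin.zero ∷ map Fin.suc (toList p)
toList (false Vec.∷ p) = map Fin.suc (toList p)

length-toList : ∀ {n} (p : Subset n) → length (toList p) ≡ ∣ p ∣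
length-toList Vec.[] = refl
length-toList (true Vec.∷ p) = cong suc (trans (length-map Fin.suc (toList p)) (length-toList p))
length-toList (false Vec.∷ p) = trans (length-map Fin.suc (toList p)) (length-toList p)

∈toList⁺ : ∀ {n} (p : Subset n) x → lookup p x ≡ true → x ∈ toList p
∈toList⁺ (true Vec.∷ p) Fin.zero _ = here refl
∈toList⁺ (true Vec.∷ p) (Fin.suc x) px = there (∈-map⁺ Fin.suc (∈toList⁺ p x px))
∈toList⁺ (false Vec.∷ p) (Fin.suc x) px = ∈-map⁺ Fin.suc (∈toList⁺ p x px)

lookup-─ : ∀ {n} (p q : Subset n) x → lookup (p ─ q) x ≡ (lookup p x ∧ not (lookup q x))
lookup-─ (a Vec.∷ p) (true Vec.∷ q) Fin.zero = sym (∧-zeroʳ a)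
lookup-─ (a Vec.∷ p) (false Vec.∷ q) Fin.zero = sym (∧-identityʳ a)
lookup-─ (a Vec.∷ p) (b Vec.∷ q) (Fin.suc x) = lookup-─ p q x

module _ where
  open ℚᵘ.≤-Reasoning

  private
    ι : ℕ → ℚᵘ
    ι m = mkℚᵘ (pos m) 0

    toℚᵘ-ℕtoℚ : ∀ m → ℚ.toℚᵘ (ℕtoℚ m) ℚᵘ.≃ ι m
    toℚᵘ-ℕtoℚ m = ℚ.toℚᵘ-fromℚᵘ (ι m)

    ι-+ : ∀ a b → ι (a + b) ℚᵘ.≃ (ι a ℚᵘ.+ ι b)
    ι-+ a b = *≡* (trans (cong (ℤ._* pos 1) (ℤ.pos-+ a b)) (lemma (pos a) (pos b)))
      where
      lemma : ∀ x y → (x ℤ.+ y) ℤ.* pos 1 ≡ (x ℤ.* pos 1 ℤ.+ y ℤ.* pos 1) ℤ.* pos 1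
      lemma = ℤ-Solver.solve-∀

    ι-* : ∀ a b → ι (a * b) ℚᵘ.≃ (ι a ℚᵘ.* ι b)
    ι-* a b = *≡* (cong (ℤ._* pos 1) (ℤ.pos-* a b))

  ℕtoℚ-+ : ∀ a b → ℕtoℚ (a + b) ≡ ℕtoℚ a ℚ.+ ℕtoℚ b
  ℕtoℚ-+ a b = ℚ.toℚᵘ-injective (begin-equality
    ℚ.toℚᵘ (ℕtoℚ (a + b))                  ≃⟨ toℚᵘ-ℕtoℚ (a + b) ⟩
    ι (a + b)                               ≃⟨ ι-+ a b ⟩
    ι a ℚᵘ.+ ι b                            ≃⟨ ℚᵘ.+-cong (toℚᵘ-ℕtoℚ a) (toℚᵘ-ℕtoℚ b) ⟨
    ℚ.toℚᵘ (ℕtoℚ a) ℚᵘ.+ ℚ.toℚᵘ (ℕtoℚ b)  ≃⟨ ℚ.toℚᵘ-homo-+ (ℕtoℚ a) (ℕtoℚ b) ⟨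
    ℚ.toℚᵘ (ℕtoℚ a ℚ.+ ℕtoℚ b)            ∎)

  ℕtoℚ-* : ∀ a b → ℕtoℚ (a * b) ≡ ℕtoℚ a ℚ.* ℕtoℚ b
  ℕtoℚ-* a b = ℚ.toℚᵘ-injective (begin-equality
    ℚ.toℚᵘ (ℕtoℚ (a * b))                  ≃⟨ toℚᵘ-ℕtoℚ (a * b) ⟩
    ι (a * b)                               ≃⟨ ι-* a b ⟩
    ι a ℚᵘ.* ι b                            ≃⟨ ℚᵘ.*-cong (toℚᵘ-ℕtoℚ a) (toℚᵘ-ℕtoℚ b) ⟨
    ℚ.toℚᵘ (ℕtoℚ a) ℚᵘ.* ℚ.toℚᵘ (ℕtoℚ b)  ≃⟨ ℚ.toℚᵘ-homo-* (ℕtoℚ a) (ℕtoℚ b) ⟨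
    ℚ.toℚᵘ (ℕtoℚ a ℚ.* ℕtoℚ b)            ∎)

  ℕtoℚ-mono-≤ : ∀ {a b} → a ≤ b → ℕtoℚ a ℚ.≤ ℕtoℚ b
  ℕtoℚ-mono-≤ {a} {b} a≤b = ℚ.toℚᵘ-cancel-≤ (begin
    ℚ.toℚᵘ (ℕtoℚ a)  ≃⟨ toℚᵘ-ℕtoℚ a ⟩
    ι a              ≤⟨ *≤* (ℤ.*-monoʳ-≤-nonNeg (pos 1) (ℤ.+≤+ a≤b)) ⟩
    ι b              ≃⟨ toℚᵘ-ℕtoℚ b ⟨
    ℚ.toℚᵘ (ℕtoℚ b)  ∎)

  ℕtoℚ-cancel-≤ : ∀ {a b} → ℕtoℚ a ℚ.≤ ℕtoℚ b → a ≤ b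
  ℕtoℚ-cancel-≤ {a} {b} a≤b with ι a ℚᵘ.≤ ι b ∋ (begin
    ι a              ≃⟨ toℚᵘ-ℕtoℚ a ⟨
    ℚ.toℚᵘ (ℕtoℚ a)  ≤⟨ ℚ.toℚᵘ-mono-≤ a≤b ⟩
    ℚ.toℚᵘ (ℕtoℚ b)  ≃⟨ toℚᵘ-ℕtoℚ b ⟩
    ι b              ∎)
  ... | *≤* a*1≤b*1 = ℤ.drop‿+≤+ (subst₂ ℤ._≤_ (ℤ.*-identityʳ (pos a)) (ℤ.*-identityʳ (pos b)) a*1≤b*1)

  ℕtoℚ-*-inverse : ∀ K .{{_ : NonZero K}} → ℕtoℚ K ℚ.* (pos 1 ℚ./ K) ≡ 1ℚ
  ℕtoℚ-*-inverse (suc d) = ℚ.toℚᵘ-injective (begin-equality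
    ℚ.toℚᵘ (ℕtoℚ (suc d) ℚ.* (pos 1 ℚ./ suc d))
      ≃⟨ ℚ.toℚᵘ-homo-* (ℕtoℚ (suc d)) (pos 1 ℚ./ suc d) ⟩
    ℚ.toℚᵘ (ℕtoℚ (suc d)) ℚᵘ.* ℚ.toℚᵘ (pos 1 ℚ./ suc d)
      ≃⟨ ℚᵘ.*-cong (toℚᵘ-ℕtoℚ (suc d)) (ℚ.toℚᵘ-fromℚᵘ (mkℚᵘ (pos 1) d)) ⟩
    ι (suc d) ℚᵘ.* mkℚᵘ (pos 1) d
      ≃⟨ ℚᵘ.*-inverseʳ (ι (suc d)) ⟩
    ℚ.toℚᵘ 1ℚ ∎)

module Scaling (K : ℕ) .{{_ : NonZero K}} where

  -- Opaque, so that conversion checking never tries to normalise 1 / K for a symbolic K (which is very slow).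
  opaque
    1/K : ℚ
    1/K = pos 1 ℚ./ K

    ℕtoℚ-*-cancel : ∀ z → ℕtoℚ (K * z) ℚ.* 1/K ≡ ℕtoℚ z
    ℕtoℚ-*-cancel z = begin
      ℕtoℚ (K * z) ℚ.* 1/K          ≡⟨ cong (ℚ._* 1/K) (trans (ℕtoℚ-* K z) (ℚ.*-comm (ℕtoℚ K) (ℕtoℚ z))) ⟩
      ℕtoℚ z ℚ.* ℕtoℚ K ℚ.* 1/K     ≡⟨ ℚ.*-assoc (ℕtoℚ z) (ℕtoℚ K) 1/K ⟩
      ℕtoℚ z ℚ.* (ℕtoℚ K ℚ.* 1/K)   ≡⟨ cong (ℕtoℚ z ℚ.*_) (ℕtoℚ-*-inverse K) ⟩
      ℕtoℚ z ℚ.* 1ℚ                 ≡⟨ ℚ.*-identityʳ (ℕtoℚ z) ⟩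
      ℕtoℚ z                        ∎
      where open ≡-Reasoning

    ℕtoℚ-*-mono-≤ : ∀ {a b} → a ≤ b → ℕtoℚ a ℚ.* 1/K ℚ.≤ ℕtoℚ b ℚ.* 1/K
    ℕtoℚ-*-mono-≤ a≤b = ℚ.*-monoʳ-≤-nonNeg 1/K {{ℚ.normalize-nonNeg 1 K}} (ℕtoℚ-mono-≤ a≤b)

if-ℕtoℚ-* : ∀ b z κ → (if b then ℕtoℚ z ℚ.* κ else 0ℚ) ≡ ℕtoℚ (if b then z else 0) ℚ.* κ
if-ℕtoℚ-* true z κ = refl
if-ℕtoℚ-* false z κ = sym (ℚ.*-zeroˡ κ)

sumℚ-ℕtoℚ-* : ∀ {n} (g : Edge n → ℚ) (z : Edge n → ℕ) κ →
  (∀ e → g e ≡ ℕtoℚ (z e) ℚ.* κ) → ∀ es → sumℚ g es ≡ ℕtoℚ (sumBy z es) ℚ.* κ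
sumℚ-ℕtoℚ-* g z κ g≡ [] = sym (ℚ.*-zeroˡ κ)
sumℚ-ℕtoℚ-* g z κ g≡ (e ∷ es) = begin
  g e ℚ.+ sumℚ g es                              ≡⟨ cong₂ ℚ._+_ (g≡ e) (sumℚ-ℕtoℚ-* g z κ g≡ es) ⟩
  ℕtoℚ (z e) ℚ.* κ ℚ.+ ℕtoℚ (sumBy z es) ℚ.* κ  ≡⟨ ℚ.*-distribʳ-+ κ (ℕtoℚ (z e)) _ ⟨
  (ℕtoℚ (z e) ℚ.+ ℕtoℚ (sumBy z es)) ℚ.* κ      ≡⟨ cong (ℚ._* κ) (ℕtoℚ-+ (z e) _) ⟨
  ℕtoℚ (z e + sumBy z es) ℚ.* κ                  ∎
  where open ≡-Reasoning

-- For c = 2t - 1 and ε = 1/c we have c (1 + ε) = c + 1, so weights in one bucket differ by a factor below (c + 1) / c.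
sameBucket⇒≤ : ∀ s j a b → InBucket (eps (suc s)) j a → InBucket (eps (suc s)) j b →
  suc (2 * s) * a ≤ suc (suc (2 * s)) * b
sameBucket⇒≤ s zero .0 b refl _ rewrite *-zeroʳ (suc (2 * s)) = z≤n
sameBucket⇒≤ s (suc i) a b (_ , a<qⁱ⁺¹) (qⁱ≤b , _) = ℕtoℚ-cancel-≤ {c * a} {suc c * b} (begin
  ℕtoℚ (c * a)               ≡⟨ ℕtoℚ-* c a ⟩
  ℕtoℚ c ℚ.* ℕtoℚ a          ≤⟨ ℚ.*-monoˡ-≤-nonNeg (ℕtoℚ c) {{ℚ.nonNegative c≥0}} a≤qb ⟩
  ℕtoℚ c ℚ.* (q ℚ.* ℕtoℚ b)  ≡⟨ ℚ.*-assoc (ℕtoℚ c) q (ℕtoℚ b) ⟨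
  (ℕtoℚ c ℚ.* q) ℚ.* ℕtoℚ b  ≡⟨ cong (ℚ._* ℕtoℚ b) cq≡1+c ⟩
  ℕtoℚ (suc c) ℚ.* ℕtoℚ b    ≡⟨ ℕtoℚ-* (suc c) b ⟨
  ℕtoℚ (suc c * b)           ∎)
  where
  open ℚ.≤-Reasoning
  c = suc (2 * s)
  ε = eps (suc s)
  q = 1ℚ ℚ.+ ε
  instance
    ε≥0 : ℚ.NonNegative ε
    ε≥0 = ℚ.normalize-nonNeg 1 c
    q≥0 : ℚ.NonNegative q
    q≥0 = ℚ.nonNeg+nonNeg⇒nonNeg 1ℚ ε
  c≥0 : 0ℚ ℚ.≤ ℕtoℚ c
  c≥0 = ℕtoℚ-mono-≤ {0} {c} z≤n
  a≤qb : ℕtoℚ a ℚ.≤ q ℚ.* ℕtoℚ b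
  a≤qb = ℚ.≤-trans (ℚ.<⇒≤ a<qⁱ⁺¹) (ℚ.*-monoˡ-≤-nonNeg q qⁱ≤b)
  cq≡1+c : ℕtoℚ c ℚ.* q ≡ ℕtoℚ (suc c)
  cq≡1+c = begin-equality
    ℕtoℚ c ℚ.* (1ℚ ℚ.+ ε)          ≡⟨ ℚ.*-distribˡ-+ (ℕtoℚ c) 1ℚ ε ⟩
    ℕtoℚ c ℚ.* 1ℚ ℚ.+ ℕtoℚ c ℚ.* ε ≡⟨ cong₂ ℚ._+_ (ℚ.*-identityʳ (ℕtoℚ c)) (ℕtoℚ-*-inverse c) ⟩
    ℕtoℚ c ℚ.+ 1ℚ                   ≡⟨ ℚ.+-comm (ℕtoℚ c) 1ℚ ⟩
    1ℚ ℚ.+ ℕtoℚ c                   ≡⟨ ℕtoℚ-+ 1 c ⟨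
    ℕtoℚ (suc c)                    ∎

module _ {A : Set} (_≟_ : DecidableEquality A) where

  occurrences : A → List A → ℕ
  occurrences x = countᵇ (λ y → does (x ≟ y))

  private
    δ : A → A → ℕ
    δ x y = if does (x ≟ y) then 1 else 0

    δ-≢ : ∀ {x y} → x ≢ y → δ x y ≡ 0
    δ-≢ {x} {y} x≢y with x ≟ y
    ... | yes x≡y = ⊥-elim (x≢y x≡y)
    ... | no _ = refl

    δ-refl : ∀ x → δ x x ≡ 1
    δ-refl x with x ≟ x
    ... | yes _ = refl
    ... | no x≢x = ⊥-elim (x≢x refl)

    sumBy-δ-∉ : ∀ (g : A → ℕ) {x} ys → ¬ x ∈ ys → sumBy (λ y → g y * δ y x) ys ≡ 0
    sumBy-δ-∉ g [] _ = refl
    sumBy-δ-∉ g (y ∷ ys) x∉ = cong₂ _+_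
      (trans (cong (g y *_) (δ-≢ (λ y≡x → x∉ (here (sym y≡x))))) (*-zeroʳ (g y)))
      (sumBy-δ-∉ g ys (x∉ ∘ there))

    sumBy-δ-∈ : ∀ (g : A → ℕ) {x} ys → Unique ys → x ∈ ys → sumBy (λ y → g y * δ y x) ys ≡ g x
    sumBy-δ-∈ g (y ∷ ys) (y∉ys ∷ _) (here refl) = begin
      g y * δ y y + sumBy (λ y′ → g y′ * δ y′ y) ys
        ≡⟨ cong₂ _+_ (cong (g y *_) (δ-refl y)) (sumBy-δ-∉ g ys (λ y∈ys → All.lookup y∉ys y∈ys refl)) ⟩
      g y * 1 + 0
        ≡⟨ trans (+-identityʳ _) (*-identityʳ (g y)) ⟩
      g y ∎
      where open ≡-Reasoning
    sumBy-δ-∈ g {x} (y ∷ ys) (y∉ys ∷ uniq) (there x∈ys) = begin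
      g y * δ y x + sumBy (λ y′ → g y′ * δ y′ x) ys
        ≡⟨ cong₂ _+_ (cong (g y *_) (δ-≢ (All.lookup y∉ys x∈ys))) (sumBy-δ-∈ g ys uniq x∈ys) ⟩
      g y * 0 + g x
        ≡⟨ cong (_+ g x) (*-zeroʳ (g y)) ⟩
      g x ∎
      where open ≡-Reasoning

    sumBy-occurrences : ∀ (g : A → ℕ) H → Unique H → ∀ xs → All (_∈ H) xs →
      sumBy (λ y → g y * occurrences y xs) H ≡ sumBy g xs
    sumBy-occurrences g H uniq xs xs⊆H = begin
      sumBy (λ y → g y * occurrences y xs) H     ≡⟨ sumBy-cong H (λ y → *-distribˡ-sumBy (g y) _ xs) ⟩
      sumBy (λ y → sumBy (λ x → g y * δ y x) xs) H ≡⟨ sumBy-swap _ H xs ⟩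
      sumBy (λ x → sumBy (λ y → g y * δ y x) H) xs ≡⟨ pointwise xs xs⊆H ⟩
      sumBy g xs                                   ∎
      where
      open ≡-Reasoning
      pointwise : ∀ zs → All (_∈ H) zs → sumBy (λ x → sumBy (λ y → g y * δ y x) H) zs ≡ sumBy g zs
      pointwise [] [] = refl
      pointwise (z ∷ zs) (z∈H ∷ zs⊆H) = cong₂ _+_ (sumBy-δ-∈ g H uniq z∈H) (pointwise zs zs⊆H)

  sumBy-weightedOccurrences : ∀ {B : Set} (g : A → ℕ) (β : B → ℕ) (L : B → List A) H O →
    Unique H → (∀ b → All (_∈ H) (L b)) →
    sumBy (λ y → g y * sumBy (λ b → β b * occurrences y (L b)) O) H ≡ sumBy (λ b → β b * sumBy g (L b)) O
  sumBy-weightedOccurrences g β L H O uniq L⊆H = begin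
    sumBy (λ y → g y * sumBy (λ b → β b * occurrences y (L b)) O) H
      ≡⟨ sumBy-cong H (λ y → *-distribˡ-sumBy (g y) _ O) ⟩
    sumBy (λ y → sumBy (λ b → g y * (β b * occurrences y (L b))) O) H
      ≡⟨ sumBy-swap _ H O ⟩
    sumBy (λ b → sumBy (λ y → g y * (β b * occurrences y (L b))) H) O
      ≡⟨ sumBy-cong O (λ b → trans (sumBy-cong H (λ y → rotate (g y) (β b) _)) (sym (*-distribˡ-sumBy (β b) _ H))) ⟩
    sumBy (λ b → β b * sumBy (λ y → g y * occurrences y (L b)) H) O
      ≡⟨ sumBy-cong O (λ b → cong (β b *_) (sumBy-occurrences g H uniq (L b) (L⊆H b))) ⟩
    sumBy (λ b → β b * sumBy g (L b)) O ∎
    where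
    open ≡-Reasoning
    rotate : ∀ a b c → a * (b * c) ≡ b * (a * c)
    rotate = solve-∀

_≟ₑ_ : ∀ {n} → DecidableEquality (Edge n)
edge a b w ≟ₑ edge a′ b′ w′ with a Fin.≟ a′ | b Fin.≟ b′ | w ≟ w′
... | yes refl | yes refl | yes refl = yes refl
... | no a≢a′ | _ | _ = no λ { refl → a≢a′ refl }
... | yes _ | no b≢b′ | _ = no λ { refl → b≢b′ refl }
... | yes _ | yes _ | no w≢w′ = no λ { refl → w≢w′ refl }

module _ {n : ℕ} {E : List (Edge n)} where

  edgesOf : ∀ {a b} → Walk E a b → List (Edge n)
  edgesOf [] = []
  edgesOf ((e , _) ∷ w) = e ∷ edgesOf w

  edgesOf⊆ : ∀ {a b} (w : Walk E a b) {e} → e ∈ edgesOf w → e ∈ E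
  edgesOf⊆ ((_ , e∈E , _) ∷ w) (here refl) = e∈E
  edgesOf⊆ (_ ∷ w) (there e∈w) = edgesOf⊆ w e∈w

  length-edgesOf : ∀ {a b} (w : Walk E a b) → length (edgesOf w) ≡ hops w
  length-edgesOf [] = refl
  length-edgesOf (_ ∷ w) = cong suc (length-edgesOf w)

  length-inner : ∀ {a b} (w : Walk E a b) → length (inner w) ≡ hops w ∸ 1
  length-inner [] = refl
  length-inner (_ ∷ []) = refl
  length-inner (_ ∷ (s ∷ w)) = cong suc (length-inner (s ∷ w))

  first∈verts : ∀ {a b} (w : Walk E a b) → a ∈ verts w
  first∈verts [] = here refl
  first∈verts (_ ∷ w) = here refl

  last∈verts : ∀ {a b} (w : Walk E a b) → b ∈ verts w
  last∈verts [] = here refl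
  last∈verts (_ ∷ w) = there (last∈verts w)

  inner⊆verts : ∀ {a b} (w : Walk E a b) {x} → x ∈ inner w → x ∈ verts w
  inner⊆verts (_ ∷ (s ∷ w)) (here refl) = there (here refl)
  inner⊆verts (_ ∷ (s ∷ w)) (there x∈w) = there (inner⊆verts (s ∷ w) x∈w)

  verts⊆ends∪inner : ∀ {a b} (w : Walk E a b) {x} → x ∈ verts w → x ≡ a ⊎ x ≡ b ⊎ x ∈ inner w
  verts⊆ends∪inner [] (here refl) = inj₁ refl
  verts⊆ends∪inner (_ ∷ w) (here refl) = inj₁ refl
  verts⊆ends∪inner (_ ∷ []) (there (here refl)) = inj₂ (inj₁ refl)
  verts⊆ends∪inner (_ ∷ (s ∷ w)) (there x∈w) with verts⊆ends∪inner (s ∷ w) x∈w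
  ... | inj₁ refl = inj₂ (inj₂ (here refl))
  ... | inj₂ (inj₁ x≡b) = inj₂ (inj₁ x≡b)
  ... | inj₂ (inj₂ x∈inner) = inj₂ (inj₂ (there x∈inner))

  ∈inner : ∀ {a b} (w : Walk E a b) {x} → x ∈ verts w → x ≢ a → x ≢ b → x ∈ inner w
  ∈inner w x∈w x≢a x≢b with verts⊆ends∪inner w x∈w
  ... | inj₁ x≡a = ⊥-elim (x≢a x≡a)
  ... | inj₂ (inj₁ x≡b) = ⊥-elim (x≢b x≡b)
  ... | inj₂ (inj₂ x∈inner) = x∈inner

  -- FarAfterFaults t f E u v says exactly that ShortWalk F (2t - 1) u v fails for some admissible F.
  ShortWalk : Subset n → ℕ → Fin n → Fin n → Set
  ShortWalk F L a b = Σ (Walk E a b) λ w → All (_∉ₛ F) (verts w) × hops w ≤ L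

  private
    FirstStep : Subset n → ℕ → Fin n → Fin n → Edge n → Set
    FirstStep F L a b e = (eu e ≡ a × ShortWalk F L (ev e) b) ⊎ (ev e ≡ a × ShortWalk F L (eu e) b)

    prepend : ∀ {F L a b} → a ∉ₛ F → ∃[ e ] e ∈ E × FirstStep F L a b e → ShortWalk F (suc L) a b
    prepend a∉F (e , e∈E , inj₁ (refl , w , w∉F , w≤L)) =
      (e , e∈E , inj₁ (refl , refl)) ∷ w , a∉F ∷ w∉F , s≤s w≤L
    prepend a∉F (e , e∈E , inj₂ (refl , w , w∉F , w≤L)) =
      (e , e∈E , inj₂ (refl , refl)) ∷ w , a∉F ∷ w∉F , s≤s w≤L

    firstStep : ∀ {F L a b} → a ≢ b → ShortWalk F (suc L) a b → Any (FirstStep F L a b) E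
    firstStep a≢b ([] , _) = ⊥-elim (a≢b refl)
    firstStep _ ((e , e∈E , inj₁ (refl , refl)) ∷ w , _ ∷ w∉F , s≤s w≤L) =
      lose e∈E (inj₁ (refl , w , w∉F , w≤L))
    firstStep _ ((e , e∈E , inj₂ (refl , refl)) ∷ w , _ ∷ w∉F , s≤s w≤L) =
      lose e∈E (inj₂ (refl , w , w∉F , w≤L))

  shortWalk? : ∀ F L a b → Dec (ShortWalk F L a b)
  firstStep? : ∀ F L a b e → Dec (FirstStep F L a b e)

  firstStep? F L a b e =
    (eu e Fin.≟ a ×-dec shortWalk? F L (ev e) b) ⊎-dec (ev e Fin.≟ a ×-dec shortWalk? F L (eu e) b)

  shortWalk? F L a b with a ∈? F
  ... | yes a∈F = no λ { ([] , a∉F ∷ _ , _) → a∉F a∈F ; (_ ∷ _ , a∉F ∷ _ , _) → a∉F a∈F }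
  ... | no a∉F with a Fin.≟ b
  ...   | yes refl = yes ([] , a∉F ∷ [] , z≤n)
  ...   | no a≢b with L
  ...     | zero = no λ { ([] , _) → a≢b refl ; (_ ∷ _ , _ , ()) }
  ...     | suc L′ with any? (firstStep? F L′ a b) E
  ...       | yes step = yes (prepend a∉F (find step))
  ...       | no ¬step = no (¬step ∘ firstStep a≢b)

  data StepIn : ∀ {a b} → Walk E a b → Edge n → Fin n → Fin n → Set where
    now   : ∀ {a c b} (s : Adj E a c) (w : Walk E c b) → StepIn (s ∷ w) (proj₁ s) a c
    later : ∀ {a c b e x y} (s : Adj E a c) {w : Walk E c b} → StepIn w e x y → StepIn (s ∷ w) e x y

  StepIn-ends : ∀ {a b} {w : Walk E a b} {e x y} → StepIn w e x y →
    (eu e ≡ x × ev e ≡ y) ⊎ (eu e ≡ y × ev e ≡ x)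
  StepIn-ends (now (_ , _ , ends) _) = ends
  StepIn-ends (later _ st) = StepIn-ends st

  StepIn-∈edgesOf : ∀ {a b} {w : Walk E a b} {e x y} → StepIn w e x y → e ∈ edgesOf w
  StepIn-∈edgesOf (now _ _) = here refl
  StepIn-∈edgesOf (later _ st) = there (StepIn-∈edgesOf st)

  StepIn-∈verts : ∀ {a b} {w : Walk E a b} {e x y} → StepIn w e x y → x ∈ verts w × y ∈ verts w
  StepIn-∈verts (now _ w) = here refl , there (first∈verts w)
  StepIn-∈verts (later _ st) with StepIn-∈verts st
  ... | x∈w , y∈w = there x∈w , there y∈w

  switchingStep : ∀ (p : Fin n → Bool) {a b} (w : Walk E a b) → p a ≡ false → p b ≡ true →
    ∃[ e ] ∃[ x ] ∃[ y ] StepIn w e x y × p x ≡ false × p y ≡ true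
  switchingStep p [] pa pb with trans (sym pa) pb
  ... | ()
  switchingStep p (_∷_ {b = c} s w) pa pb with p c in pc
  ... | true = proj₁ s , _ , c , now s w , pa , pc
  ... | false with switchingStep p w pc pb
  ...   | e , x , y , st , px , py = e , x , y , later s st , px , py

  pathWithStep⇒edge : ∀ {a b e} (w : Walk E a b) → IsPath w → StepIn w e a b → verts w ≡ a ∷ b ∷ []
  pathWithStep⇒edge (_ ∷ w) (_ ∷ uniq) (now _ _) = cong (_ ∷_) (loop w uniq)
    where
    loop : ∀ {c} (w : Walk E c c) → Unique (verts w) → verts w ≡ c ∷ []
    loop [] _ = refl
    loop (_ ∷ w) (c∉w ∷ _) = ⊥-elim (All.lookup c∉w (last∈verts w) refl)
  pathWithStep⇒edge (_ ∷ w) (a∉w ∷ _) (later _ st) = ⊥-elim (All.lookup a∉w (proj₁ (StepIn-∈verts st)) refl)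

module _ {n : ℕ} {E : List (Edge n)} {u v : Fin n} where

  -- Walks may revisit u and v, which can never be faulted.
  interior : Walk E u v → List (Fin n)
  interior w = filter (λ x → ¬? (x Fin.≟ u) ×-dec ¬? (x Fin.≟ v)) (inner w)

  interior⊆verts : (w : Walk E u v) → ∀ {x} → x ∈ interior w → x ∈ verts w
  interior⊆verts w x∈ = inner⊆verts w (proj₁ (∈-filter⁻ _ {xs = inner w} x∈))

  InteriorDisjoint : Walk E u v → Walk E u v → Set
  InteriorDisjoint w w′ = Disjoint (interior w) (interior w′)

  private
    faults : List (Walk E u v) → List (Fin n)
    faults [] = []
    faults (w ∷ ws) = interior w ++ faults ws

    length-faults : ∀ {L} ws → All (λ w → hops w ≤ L) ws → length (faults ws) ≤ length ws * (L ∸ 1)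
    length-faults [] [] = z≤n
    length-faults {L} (w ∷ ws) (w≤L ∷ ws≤L) = begin
      length (interior w ++ faults ws)          ≡⟨ length-++ (interior w) ⟩
      length (interior w) + length (faults ws)  ≤⟨ +-mono-≤ interior≤ (length-faults ws ws≤L) ⟩
      (L ∸ 1) + length ws * (L ∸ 1)             ∎
      where
      open ≤-Reasoning
      interior≤ : length (interior w) ≤ L ∸ 1
      interior≤ = ≤-trans (length-filter _ (inner w))
        (≤-trans (≤-reflexive (length-inner w)) (∸-monoˡ-≤ 1 w≤L))

    ∈faults⁺ : ∀ ws {w x} → w ∈ ws → x ∈ interior w → x ∈ faults ws
    ∈faults⁺ (w ∷ ws) (here refl) x∈w = ∈-++⁺ˡ x∈w
    ∈faults⁺ (w ∷ ws) (there w∈ws) x∈w = ∈-++⁺ʳ (interior w) (∈faults⁺ ws w∈ws x∈w)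

    faults-notEnd : ∀ ws {x} → x ∈ faults ws → x ≢ u × x ≢ v
    faults-notEnd (w ∷ ws) x∈ with ∈-++⁻ (interior w) x∈
    ... | inj₁ x∈w = proj₂ (∈-filter⁻ _ {xs = inner w} x∈w)
    ... | inj₂ x∈ws = faults-notEnd ws x∈ws

  module _ {t f : ℕ} (near : ¬ FarAfterFaults t f E u v) where

    private
      -- Faulting the interiors of the walks found so far still leaves a short u–v walk.
      extend : ∀ ws → All (λ w → hops w ≤ 2 * t ∸ 1) ws → length ws * (2 * t ∸ 1 ∸ 1) ≤ f →
        Σ (Walk E u v) λ w → hops w ≤ 2 * t ∸ 1 × All (InteriorDisjoint w) ws
      extend ws ws-short size with shortWalk? (fromList (faults ws)) (2 * t ∸ 1) u v
      ... | yes (w , w∉F , w-short) = w , w-short , All.tabulate λ w′∈ws x∈w x∈w′ →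
            All.lookup w∉F (interior⊆verts w x∈w) (∈fromList⁺ (faults ws) (∈faults⁺ ws w′∈ws x∈w′))
      ... | no noShortWalk = ⊥-elim (near (F , u∉F , v∉F , ∣F∣≤f , noShortWalk))
        where
        F = fromList (faults ws)
        u∉F : u ∉ₛ F
        u∉F u∈F = proj₁ (faults-notEnd ws (∈fromList⁻ (faults ws) u∈F)) refl
        v∉F : v ∉ₛ F
        v∉F v∈F = proj₂ (faults-notEnd ws (∈fromList⁻ (faults ws) v∈F)) refl
        ∣F∣≤f : ∣ F ∣ ≤ f
        ∣F∣≤f = ≤-trans (∣fromList∣≤length (faults ws)) (≤-trans (length-faults ws ws-short) size)

    disjointShortWalks : ∀ m → m * (2 * t ∸ 1 ∸ 1) ≤ f → Σ (List (Walk E u v)) λ ws →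
      length ws ≡ suc m × All (λ w → hops w ≤ 2 * t ∸ 1) ws × AllPairs InteriorDisjoint ws
    disjointShortWalks zero _ with extend [] [] z≤n
    ... | w , w-short , _ = w ∷ [] , refl , w-short ∷ [] , [] ∷ []
    disjointShortWalks (suc m) size with disjointShortWalks m (≤-trans (m≤n+m _ _) size)
    ... | ws , len , ws-short , disjoint
      with extend ws ws-short (subst (λ k → k * (2 * t ∸ 1 ∸ 1) ≤ f) (sym len) size)
    ...   | w , w-short , w#ws = w ∷ ws , cong suc len , w-short ∷ ws-short , w#ws ∷ disjoint

module Biset {n : ℕ} (S S⁺ : Subset n) (S⊆S⁺ : ∀ x → lookup S x ≡ true → lookup S⁺ x ≡ true) where

  boundary : Fin n → Bool
  boundary x = lookup S⁺ x ∧ not (lookup S x)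

  boundary-S : ∀ {x} → lookup S x ≡ true → boundary x ≡ false
  boundary-S {x} Sx rewrite Sx = ∧-zeroʳ (lookup S⁺ x)

  boundary-∉S⁺ : ∀ {x} → lookup S⁺ x ≡ false → boundary x ≡ false
  boundary-∉S⁺ S⁺x rewrite S⁺x = refl

  Separates : Fin n → Fin n → Set
  Separates u v = (lookup S u ≡ true × lookup S⁺ v ≡ false) ⊎ (lookup S⁺ u ≡ false × lookup S v ≡ true)

  S∩∉S⁺ : ∀ {x} → lookup S x ≡ true → lookup S⁺ x ≡ false → Empty
  S∩∉S⁺ {x} Sx S⁺x with trans (sym (S⊆S⁺ x Sx)) S⁺x
  ... | ()

  crosses-≡true : ∀ e {x y} → (eu e ≡ x × ev e ≡ y) ⊎ (eu e ≡ y × ev e ≡ x) →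
    lookup S x ≡ true → lookup S⁺ y ≡ false → crosses S S⁺ e ≡ true
  crosses-≡true e (inj₁ (refl , refl)) Sx S⁺y rewrite Sx | S⁺y = refl
  crosses-≡true e (inj₂ (refl , refl)) Sx S⁺y rewrite Sx | S⁺y = ∨-zeroʳ _

  crosses-ends : ∀ e → crosses S S⁺ e ≡ true → Separates (eu e) (ev e)
  crosses-ends e cr with lookup S (eu e) | lookup S⁺ (ev e) | lookup S (ev e) | lookup S⁺ (eu e)
  ... | true  | false | _    | _     = inj₁ (refl , refl)
  ... | true  | true  | true | false = inj₂ (refl , refl)
  ... | false | _     | true | false = inj₂ (refl , refl)

  ∉S⁺⇒∉S : ∀ {x} → lookup S⁺ x ≡ false → lookup S x ≡ false
  ∉S⁺⇒∉S {x} S⁺x with lookup S x in Sx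
  ... | true = ⊥-elim (S∩∉S⁺ Sx S⁺x)
  ... | false = refl

  ∈S⁺⇒∈S : ∀ {x} → boundary x ≡ false → lookup S⁺ x ≡ true → lookup S x ≡ true
  ∈S⁺⇒∈S {x} = lemma (lookup S x) (lookup S⁺ x)
    where
    lemma : ∀ s s⁺ → (s⁺ ∧ not s) ≡ false → s⁺ ≡ true → s ≡ true
    lemma true  _     _  _  = refl
    lemma false true  () _
    lemma false false _  ()

  ∉S⇒∉S⁺ : ∀ {x} → boundary x ≡ false → lookup S x ≡ false → lookup S⁺ x ≡ false
  ∉S⇒∉S⁺ {x} = lemma (lookup S x) (lookup S⁺ x)
    where
    lemma : ∀ s s⁺ → (s⁺ ∧ not s) ≡ false → s ≡ false → s⁺ ≡ false
    lemma false false _  _  = refl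
    lemma false true  () _
    lemma true  _     _  ()

  boundaryVertex? : ∀ xs → (∃[ x ] x ∈ xs × boundary x ≡ true) ⊎ All (λ x → boundary x ≡ false) xs
  boundaryVertex? [] = inj₂ []
  boundaryVertex? (x ∷ xs) with boundary x in bx | boundaryVertex? xs
  ... | true  | _ = inj₁ (x , here refl , bx)
  ... | false | inj₁ (y , y∈xs , by) = inj₁ (y , there y∈xs , by)
  ... | false | inj₂ none = inj₂ (bx ∷ none)

  module _ {E : List (Edge n)} where

    boundaryFree : ∀ {a b} (w : Walk E a b) → boundary a ≡ false → boundary b ≡ false →
      All (λ x → boundary x ≡ false) (inner w) → All (λ x → boundary x ≡ false) (verts w)
    boundaryFree w ba bb none = All.tabulate λ x∈w → endOrInner (verts⊆ends∪inner w x∈w)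
      where
      endOrInner : ∀ {x} → x ≡ _ ⊎ x ≡ _ ⊎ x ∈ inner w → boundary x ≡ false
      endOrInner (inj₁ refl) = ba
      endOrInner (inj₂ (inj₁ refl)) = bb
      endOrInner (inj₂ (inj₂ x∈inner)) = All.lookup none x∈inner

    -- Along a boundary-free walk, S (resp. S⁺) switches only across an edge crossing the biset.
    crossingStep⁻ : ∀ {a b} (w : Walk E a b) → All (λ x → boundary x ≡ false) (verts w) →
      lookup S⁺ a ≡ false → lookup S b ≡ true →
      ∃[ e ] ∃[ x ] ∃[ y ] StepIn w e x y × lookup S⁺ x ≡ false × lookup S y ≡ true
    crossingStep⁻ {a} w free S⁺a Sb with switchingStep (lookup S) w (∉S⁺⇒∉S S⁺a) Sb
    ... | e , x , y , st , Sx , Sy =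
      e , x , y , st , ∉S⇒∉S⁺ (All.lookup free (proj₁ (StepIn-∈verts st))) Sx , Sy

    crossingStep⁺ : ∀ {a b} (w : Walk E a b) → All (λ x → boundary x ≡ false) (verts w) →
      lookup S a ≡ true → lookup S⁺ b ≡ false →
      ∃[ e ] ∃[ x ] ∃[ y ] StepIn w e x y × lookup S x ≡ true × lookup S⁺ y ≡ false
    crossingStep⁺ {a} w free Sa S⁺b
      with switchingStep (not ∘ lookup S⁺) w (cong not (S⊆S⁺ a Sa)) (cong not S⁺b)
    ... | e , x , y , st , S⁺x , S⁺y =
      e , x , y , st , ∈S⁺⇒∈S (All.lookup free (proj₁ (StepIn-∈verts st))) (not-≡false S⁺x) , not-≡true S⁺y
      where
      not-≡false : ∀ {b} → not b ≡ false → b ≡ true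
      not-≡false {true} _ = refl
      not-≡true : ∀ {b} → not b ≡ true → b ≡ false
      not-≡true {false} _ = refl

    private
      boundary⊆toList : ∀ {x} → boundary x ≡ true → x ∈ toList (S⁺ ─ S)
      boundary⊆toList {x} bx = ∈toList⁺ (S⁺ ─ S) x (trans (lookup-─ S⁺ S x) bx)

      -- Separated vertices are off the boundary, so a walk with boundary-free interior is boundary-free.
      crossingIfNoBoundary : ∀ {u v} → Separates u v →
        (w : Walk E u v) → All (λ x → boundary x ≡ false) (interior w) → 1 ≤ countᵇ (crosses S S⁺) (edgesOf w)
      crossingIfNoBoundary {u} {v} ends w none = crossing ends
        where
        bEnd : ∀ {x} → lookup S x ≡ true ⊎ lookup S⁺ x ≡ false → boundary x ≡ false
        bEnd (inj₁ Sx) = boundary-S Sx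
        bEnd (inj₂ S⁺x) = boundary-∉S⁺ S⁺x
        bu : boundary u ≡ false
        bu = bEnd (map-⊎ proj₁ proj₁ ends)
        bv : boundary v ≡ false
        bv = bEnd (swap (map-⊎ proj₂ proj₂ ends))
        notEnd : ∀ {x} → x ∈ inner w → boundary x ≡ false
        notEnd {x} x∈inner with x Fin.≟ u | x Fin.≟ v
        ... | yes refl | _ = bu
        ... | no _ | yes refl = bv
        ... | no x≢u | no x≢v = All.lookup none (∈-filter⁺ _ x∈inner (x≢u , x≢v))
        free : All (λ x → boundary x ≡ false) (verts w)
        free = boundaryFree w bu bv (All.tabulate notEnd)
        crossing : Separates u v → 1 ≤ countᵇ (crosses S S⁺) (edgesOf w)
        crossing (inj₁ (Su , S⁺v)) with crossingStep⁺ w free Su S⁺v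
        ... | e , x , y , st , Sx , S⁺y =
          countᵇ-∈ (crosses S S⁺) (edgesOf w) (StepIn-∈edgesOf st) (crosses-≡true e (StepIn-ends st) Sx S⁺y)
        crossing (inj₂ (S⁺u , Sv)) with crossingStep⁻ w free S⁺u Sv
        ... | e , x , y , st , S⁺x , Sy =
          countᵇ-∈ (crosses S S⁺) (edgesOf w) (StepIn-∈edgesOf st) (crosses-≡true e (swap (StepIn-ends st)) Sy S⁺x)

      crossings : ∀ {u v} → List (Walk E u v) → ℕ
      crossings = sumBy (countᵇ (crosses S S⁺) ∘ edgesOf)

      -- Each walk is charged to a boundary vertex of its interior or to one of its crossing edges.
      charge : ∀ {u v} → Separates u v →
        (ws : List (Walk E u v)) → AllPairs InteriorDisjoint ws →
        ∃[ hs ] Unique hs × All (λ x → boundary x ≡ true) hs ×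
          (∀ {x} → x ∈ hs → ∃[ w ] w ∈ ws × x ∈ interior w) × length ws ≤ length hs + crossings ws
      charge ends [] [] = [] , [] , [] , (λ ()) , z≤n
      charge ends (w ∷ ws) (w#ws ∷ disjoint) with charge ends ws disjoint | boundaryVertex? (interior w)
      ... | hs , uniq , hs⊆∂ , hs⊆ws , count | inj₁ (x , x∈w , bx) =
        x ∷ hs , All.tabulate x≢ ∷ uniq , bx ∷ hs⊆∂ , source ,
        s≤s (≤-trans count (+-monoʳ-≤ (length hs) (m≤n+m (crossings ws) (countᵇ (crosses S S⁺) (edgesOf w)))))
        where
        x≢ : ∀ {y} → y ∈ hs → x ≢ y
        x≢ y∈hs refl with hs⊆ws y∈hs
        ... | w′ , w′∈ws , x∈w′ = All.lookup w#ws w′∈ws x∈w x∈w′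
        source : ∀ {y} → y ∈ x ∷ hs → ∃[ w′ ] w′ ∈ w ∷ ws × y ∈ interior w′
        source (here refl) = w , here refl , x∈w
        source (there y∈hs) with hs⊆ws y∈hs
        ... | w′ , w′∈ws , y∈w′ = w′ , there w′∈ws , y∈w′
      ... | hs , uniq , hs⊆∂ , hs⊆ws , count | inj₂ none =
        hs , uniq , hs⊆∂ , source , (begin
          suc (length ws)                    ≤⟨ s≤s count ⟩
          suc (length hs + crossings ws)     ≡⟨ +-suc (length hs) _ ⟨
          length hs + suc (crossings ws)     ≤⟨ +-monoʳ-≤ (length hs) (+-monoˡ-≤ _ (crossingIfNoBoundary ends w none)) ⟩
          length hs + crossings (w ∷ ws)     ∎)
        where
        open ≤-Reasoning
        source : ∀ {y} → y ∈ hs → ∃[ w′ ] w′ ∈ w ∷ ws × y ∈ interior w′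
        source y∈hs with hs⊆ws y∈hs
        ... | w′ , w′∈ws , y∈w′ = w′ , there w′∈ws , y∈w′

    interiorDisjoint-cutBound : ∀ {u v} → Separates u v →
      (ws : List (Walk E u v)) → AllPairs InteriorDisjoint ws →
      length ws ≤ ∣ S⁺ ─ S ∣ + sumBy (countᵇ (crosses S S⁺) ∘ edgesOf) ws
    interiorDisjoint-cutBound ends ws disjoint with hs , uniq , hs⊆∂ , _ , count ← charge ends ws disjoint =
      ≤-trans count (+-monoˡ-≤ _ (subst (length hs ≤_) (length-toList (S⁺ ─ S))
        (unique⊆⇒length≤ hs (toList (S⁺ ─ S)) uniq (All.map boundary⊆toList hs⊆∂))))

    private
      Witness : ∀ {u v} → Walk E u v → Fin n ⊎ Edge n → Set
      Witness w (inj₁ x) = x ∈ inner w × boundary x ≡ true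
      Witness w (inj₂ e) = ∃[ x ] ∃[ y ] StepIn w e x y × lookup S⁺ x ≡ false × lookup S y ≡ true

      witness : ∀ {u v} → lookup S⁺ u ≡ false → lookup S v ≡ true → (w : Walk E u v) → Σ _ (Witness w)
      witness S⁺u Sv w with boundaryVertex? (inner w)
      ... | inj₁ (x , x∈w , bx) = inj₁ x , x∈w , bx
      ... | inj₂ none with crossingStep⁻ w (boundaryFree w (boundary-∉S⁺ S⁺u) (boundary-S Sv) none) S⁺u Sv
      ...   | e , x , y , st , S⁺x , Sy = inj₂ e , x , y , st , S⁺x , Sy

      -- Two internally disjoint u–v paths through the same crossing edge x → y would share x and y, so x = u and y = v.
      witness-injective : ∀ {u v} → lookup S⁺ u ≡ false → lookup S v ≡ true → (w w′ : Walk E u v) →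
        IsPath w → IsPath w′ → verts w ≢ verts w′ → Disjoint (inner w) (inner w′) →
        ∀ c → Witness w c → Witness w′ c → Empty
      witness-injective _ _ w w′ _ _ _ disjoint (inj₁ x) (x∈w , _) (x∈w′ , _) = disjoint x∈w x∈w′
      witness-injective {u} {v} S⁺u Sv w w′ pw pw′ w≢w′ disjoint (inj₂ e)
        (x , y , st , S⁺x , Sy) (x′ , y′ , st′ , S⁺x′ , Sy′)
        with sameEnds (StepIn-ends st) (StepIn-ends st′) S⁺x Sy S⁺x′ Sy′
        where
        sameEnds : ∀ {x y x′ y′} → (eu e ≡ x × ev e ≡ y) ⊎ (eu e ≡ y × ev e ≡ x) →
          (eu e ≡ x′ × ev e ≡ y′) ⊎ (eu e ≡ y′ × ev e ≡ x′) →
          lookup S⁺ x ≡ false → lookup S y ≡ true → lookup S⁺ x′ ≡ false → lookup S y′ ≡ true →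
          x ≡ x′ × y ≡ y′
        sameEnds (inj₁ (refl , refl)) (inj₁ (refl , refl)) _ _ _ _ = refl , refl
        sameEnds (inj₂ (refl , refl)) (inj₂ (refl , refl)) _ _ _ _ = refl , refl
        sameEnds (inj₁ (refl , refl)) (inj₂ (refl , refl)) S⁺x _ _ Sy′ = ⊥-elim (S∩∉S⁺ Sy′ S⁺x)
        sameEnds (inj₂ (refl , refl)) (inj₁ (refl , refl)) _ Sy S⁺x′ _ = ⊥-elim (S∩∉S⁺ Sy S⁺x′)
      ... | refl , refl with y Fin.≟ v | x Fin.≟ u
      ...   | no y≢v | _ =
        disjoint (∈inner w (proj₂ (StepIn-∈verts st)) y≢u y≢v) (∈inner w′ (proj₂ (StepIn-∈verts st′)) y≢u y≢v)
        where
        y≢u : y ≢ u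
        y≢u refl = S∩∉S⁺ Sy S⁺u
      ...   | yes refl | no x≢u =
        disjoint (∈inner w (proj₁ (StepIn-∈verts st)) x≢u x≢v) (∈inner w′ (proj₁ (StepIn-∈verts st′)) x≢u x≢v)
        where
        x≢v : x ≢ v
        x≢v refl = S∩∉S⁺ Sv S⁺x
      ...   | yes refl | yes refl = w≢w′ (trans (pathWithStep⇒edge w pw st) (sym (pathWithStep⇒edge w′ pw′ st′)))


    -- Menger's cut bound: each path meets the boundary or a crossing edge, and no two paths share one.
    disjointPaths-cutBound : ∀ {u v R} → lookup S⁺ u ≡ false → lookup S v ≡ true →
      HasDisjointPaths E u v R → R ≤ ∣ S⁺ ─ S ∣ + countᵇ (crosses S S⁺) E
    disjointPaths-cutBound {u} {v} {R} S⁺u Sv (P , isPath , pairwise) =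
      subst₂ _≤_ (length-tabulate c) length-candidates
        (unique⊆⇒length≤ (tabulate c) candidates (AllPairs.tabulate⁺ c-injective) (All.tabulate⁺ c∈candidates))
      where
      c : Fin R → Fin n ⊎ Edge n
      c i = proj₁ (witness S⁺u Sv (P i))
      c-injective : ∀ {i j} → i ≢ j → c i ≢ c j
      c-injective {i} {j} i≢j ci≡cj = witness-injective S⁺u Sv (P i) (P j) (isPath i) (isPath j)
        (proj₁ (pairwise i j i≢j)) (proj₂ (pairwise i j i≢j)) (c j)
        (subst (Witness (P i)) ci≡cj (proj₂ (witness S⁺u Sv (P i)))) (proj₂ (witness S⁺u Sv (P j)))
      candidates : List (Fin n ⊎ Edge n)
      candidates = map inj₁ (toList (S⁺ ─ S)) ++ map inj₂ (filterᵇ (crosses S S⁺) E)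
      length-candidates : length candidates ≡ ∣ S⁺ ─ S ∣ + countᵇ (crosses S S⁺) E
      length-candidates = begin
        length candidates                                                    ≡⟨ length-++ (map inj₁ (toList (S⁺ ─ S))) ⟩
        length (map inj₁ (toList (S⁺ ─ S))) + length (map inj₂ (filterᵇ (crosses S S⁺) E))
          ≡⟨ cong₂ _+_ (trans (length-map inj₁ (toList (S⁺ ─ S))) (length-toList (S⁺ ─ S)))
                       (trans (length-map inj₂ (filterᵇ (crosses S S⁺) E)) (length-filterᵇ (crosses S S⁺) E)) ⟩
        ∣ S⁺ ─ S ∣ + countᵇ (crosses S S⁺) E ∎
        where open ≡-Reasoning
      c∈candidates : ∀ i → c i ∈ candidates
      c∈candidates i with witness S⁺u Sv (P i)
      ... | inj₁ x , _ , bx = ∈-++⁺ˡ (∈-map⁺ inj₁ (boundary⊆toList bx))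
      ... | inj₂ e , x , y , st , S⁺x , Sy = ∈-++⁺ʳ (map inj₁ (toList (S⁺ ─ S))) (∈-map⁺ inj₂
        (∈-filter⁺ (T? ∘ crosses S S⁺) (edgesOf⊆ (P i) (StepIn-∈edgesOf st))
          (subst T (sym (crosses-≡true e (swap (StepIn-ends st)) Sy S⁺x)) tt)))

module _ {n : ℕ} {t f : ℕ} {ε : ℚ} where

  BucketsCorrect : State n → Set
  BucketsCorrect = All (λ { (j , e) → InBucket ε j (wt e) })

  private
    ∈bucketGraph⇒∈ : ∀ (st : State n) j {e} → e ∈ bucketGraph st j → (j , e) ∈ st
    ∈bucketGraph⇒∈ ((i , e′) ∷ st) j e∈ with i ≟ j
    ∈bucketGraph⇒∈ ((i , e′) ∷ st) j (here refl) | yes refl = here refl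
    ∈bucketGraph⇒∈ ((i , e′) ∷ st) j (there e∈) | yes refl = there (∈bucketGraph⇒∈ st j e∈)
    ... | no _ = there (∈bucketGraph⇒∈ st j e∈)

  output-mono : ∀ {st : State n} {es st′} → Run t f ε st es st′ → ∀ {e} → e ∈ output st → e ∈ output st′
  output-mono done e∈ = e∈
  output-mono (keep _ _ _ run) e∈ = output-mono run (there e∈)
  output-mono (skip _ _ _ run) e∈ = output-mono run e∈

  rejected : ∀ {st : State n} {es st′} → Run t f ε st es st′ → BucketsCorrect st →
    ∀ {e} → e ∈ es → ¬ e ∈ output st′ →
    ∃[ j ] ∃[ st₀ ] InBucket ε j (wt e) × ¬ FarAfterFaults t f (bucketGraph st₀ j) (eu e) (ev e) ×
      (∀ {e′} → e′ ∈ bucketGraph st₀ j → e′ ∈ output st′ × InBucket ε j (wt e′))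
  rejected (keep j _ _ run) _ (here refl) e∉ = ⊥-elim (e∉ (output-mono run (here refl)))
  rejected (keep j bucket _ run) ok (there e∈) e∉ = rejected run (bucket ∷ ok) e∈ e∉
  rejected {st} (skip j bucket near run) ok (here refl) _ = j , st , bucket , near ,
    λ e′∈ → let j,e′∈st = ∈bucketGraph⇒∈ st j e′∈ in
      output-mono run (∈-map⁺ proj₂ j,e′∈st) , All.lookup ok j,e′∈st
  rejected (skip _ _ _ run) ok (there e∈) e∉ = rejected run ok e∈ e∉

  output-unique : ∀ {st : State n} {es st′} → Run t f ε st es st′ → Unique (output st) →
    All (λ e → ¬ e ∈ output st) es → Unique es → Unique (output st′)
  output-unique done uniq _ _ = uniq
  output-unique {st} {e ∷ _} (keep j _ _ run) uniq (e∉st ∷ es∉st) (e∉es ∷ uniqᵉ) =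
    output-unique run (All.tabulate (λ x∈st → λ { refl → e∉st x∈st }) ∷ uniq)
      (All.zipWith new (es∉st , e∉es)) uniqᵉ
    where
    new : ∀ {e′} → ¬ e′ ∈ output st × e ≢ e′ → ¬ e′ ∈ output ((j , e) ∷ st)
    new (e′∉st , e≢e′) (here e′≡e) = e≢e′ (sym e′≡e)
    new (e′∉st , _) (there e′∈st) = e′∉st e′∈st
  output-unique (skip _ _ _ run) uniq (_ ∷ es∉st) (_ ∷ uniqᵉ) = output-unique run uniq es∉st uniqᵉ

faultBudget : ∀ t k → 2 * (k ∸ 1) * (2 * t ∸ 1 ∸ 1) ≤ (2 * t ∸ 2) * (2 * k ∸ 1)
faultBudget t k = begin
  2 * (k ∸ 1) * (2 * t ∸ 1 ∸ 1) ≡⟨ cong (2 * (k ∸ 1) *_) (∸-+-assoc (2 * t) 1 1) ⟩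
  2 * (k ∸ 1) * (2 * t ∸ 2)     ≤⟨ *-monoˡ-≤ (2 * t ∸ 2) (≤-reflexive (*-distribˡ-∸ 2 k 1)) ⟩
  (2 * k ∸ 2) * (2 * t ∸ 2)     ≤⟨ *-monoˡ-≤ (2 * t ∸ 2) (∸-monoʳ-≤ (2 * k) (s≤s z≤n)) ⟩
  (2 * k ∸ 1) * (2 * t ∸ 2)     ≡⟨ *-comm (2 * k ∸ 1) _ ⟩
  (2 * t ∸ 2) * (2 * k ∸ 1)     ∎
  where open ≤-Reasoning

routeCost : ∀ a s w → suc (2 * a) * (suc (suc (2 * s)) * w) ≤ suc a * (4 * suc s * w)
routeCost a s w = ≤-trans (*-monoˡ-≤ _ (n≤1+n (suc (2 * a)))) (≤-reflexive (identity a s w))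
  where
  identity : ∀ a s w → suc (suc (2 * a)) * (suc (suc (2 * s)) * w) ≡ suc a * (4 * suc s * w)
  identity = solve-∀

cutCount : ∀ a d c → d ≤ a → suc (2 * a) ≤ d + c → suc a ≤ c
cutCount a d c d≤a 2a<d+c = +-cancelˡ-≤ a (suc a) c (begin
  a + suc a     ≡⟨ double a ⟩
  suc (2 * a)   ≤⟨ 2a<d+c ⟩
  d + c         ≤⟨ +-monoˡ-≤ c d≤a ⟩
  a + c         ∎)
  where
  open ≤-Reasoning
  double : ∀ a → a + suc a ≡ suc (2 * a)
  double = solve-∀

module _ {n : ℕ} (r : Req n) where

  r≤maxReq : ∀ u v → r u v ≤ maxReq r
  r≤maxReq u v = ≤-trans (≤max (r u) (allFin n) (∈-allFin v))
    (≤max (λ u′ → foldr _⊔_ 0 (map (r u′) (allFin n))) (allFin n) (∈-allFin u))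

  hBiset-attained : ∀ S S⁺ → hBiset r S S⁺ ≡ 0 ⊎
    ∃[ u ] ∃[ v ] lookup S v ≡ true × lookup S⁺ u ≡ false × hBiset r S S⁺ ≡ r u v ∸ ∣ S⁺ ─ S ∣
  hBiset-attained S S⁺ with max-attained (λ v → foldr _⊔_ 0 (map (term v) (allFin n))) (allFin n)
    where
    term : Fin n → Fin n → ℕ
    term v u = if lookup S v ∧ not (lookup S⁺ u) then r u v else 0
  ... | inj₁ max≡0 = inj₁ (trans (cong (_∸ ∣ S⁺ ─ S ∣) max≡0) (0∸n≡0 ∣ S⁺ ─ S ∣))
  ... | inj₂ (v , max≡) with max-attained (λ u → if lookup S v ∧ not (lookup S⁺ u) then r u v else 0) (allFin n)
  ...   | inj₁ max′≡0 = inj₁ (trans (cong (_∸ ∣ S⁺ ─ S ∣) (trans max≡ max′≡0)) (0∸n≡0 ∣ S⁺ ─ S ∣))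
  ...   | inj₂ (u , max′≡) with lookup S v in Sv | lookup S⁺ u in S⁺u
  ...     | true  | false = inj₂ (u , v , Sv , S⁺u , cong (_∸ ∣ S⁺ ─ S ∣) (trans max≡ max′≡))
  ...     | true  | true  = inj₁ (trans (cong (_∸ ∣ S⁺ ─ S ∣) (trans max≡ max′≡)) (0∸n≡0 ∣ S⁺ ─ S ∣))
  ...     | false | _     = inj₁ (trans (cong (_∸ ∣ S⁺ ─ S ∣) (trans max≡ max′≡)) (0∸n≡0 ∣ S⁺ ─ S ∣))

shortWalkWeight : ∀ s {n} {E : List (Edge n)} {j a b w₀} (w : Walk E a b) → hops w ≤ 2 * suc s ∸ 1 →
  (∀ {e} → e ∈ E → InBucket (eps (suc s)) j (wt e)) → InBucket (eps (suc s)) j w₀ →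
  sumBy wt (edgesOf w) ≤ suc (suc (2 * s)) * w₀
shortWalkWeight s {j = j} {w₀ = w₀} w short E⊆bucket w₀∈bucket = *-cancelˡ-≤ c (begin
  c * sumBy wt (edgesOf w)             ≡⟨ *-distribˡ-sumBy c wt (edgesOf w) ⟩
  sumBy (λ e → c * wt e) (edgesOf w)   ≤⟨ sumBy-mono (edgesOf w) (λ e∈w →
                                            sameBucket⇒≤ s j _ w₀ (E⊆bucket (edgesOf⊆ w e∈w)) w₀∈bucket) ⟩
  sumBy (λ _ → suc c * w₀) (edgesOf w) ≡⟨ sumBy-const (suc c * w₀) (edgesOf w) ⟩
  length (edgesOf w) * (suc c * w₀)    ≤⟨ *-monoˡ-≤ (suc c * w₀) length≤c ⟩
  c * (suc c * w₀)                     ∎)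
  where
  open ≤-Reasoning
  c = suc (2 * s)
  length≤c : length (edgesOf w) ≤ c
  length≤c = subst₂ _≤_ (sym (length-edgesOf w)) (+-suc s (s + 0)) short

totalWeight≡sumBy : ∀ {n} (es : List (Edge n)) → totalWeight es ≡ sumBy wt es
totalWeight≡sumBy [] = refl
totalWeight≡sumBy (e ∷ es) = cong (wt e +_) (totalWeight≡sumBy es)

module _ {n : ℕ} (G : List (Edge n)) (r : Req n) (s : ℕ) {H : State n}
  (run : Run (suc s) ((2 * suc s ∸ 2) * (2 * maxReq r ∸ 1)) (eps (suc s)) [] G H) where

  private
    t = suc s
    k = maxReq r
    K = suc (k ∸ 1)

  -- e is replaced by mult copies of route inside H; the LP solution finally divides by K.
  record Reroute (e : Edge n) : Set where
    field
      mult    : ℕ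
      route   : List (Edge n)
      route⊆H : All (_∈ output H) route
      cost    : mult * sumBy wt route ≤ K * (4 * t * wt e)
      cut     : e ∈ G → ∀ S S⁺ → (∀ x → lookup S x ≡ true → lookup S⁺ x ≡ true) →
                crosses S S⁺ e ≡ true → ∣ S⁺ ─ S ∣ < k → K ≤ mult * countᵇ (crosses S S⁺) route

  private
    kept : ∀ {e} → e ∈ output H → Reroute e
    kept {e} e∈H = record
      { mult = K ; route = e ∷ [] ; route⊆H = e∈H ∷ []
      ; cost = *-monoʳ-≤ K (subst (_≤ 4 * t * wt e) (sym (+-identityʳ (wt e))) (m≤n*m (wt e) (4 * t)))
      ; cut = λ { _ S S⁺ _ cr _ →
          subst (λ b → K ≤ K * ((if b then 1 else 0) + 0)) (sym cr) (≤-reflexive (sym (*-identityʳ K))) }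
      }

    detour : ∀ {e} j {E : List (Edge n)} → InBucket (eps t) j (wt e) →
      ¬ FarAfterFaults t ((2 * t ∸ 2) * (2 * k ∸ 1)) E (eu e) (ev e) →
      (∀ {e′} → e′ ∈ E → e′ ∈ output H × InBucket (eps t) j (wt e′)) → Reroute e
    detour {e} j {E} e∈bucket near E⊆ with disjointShortWalks {t = t} near (2 * (k ∸ 1)) (faultBudget t k)
    ... | ws , length-ws , short , disjoint = record
      { mult = 1 ; route = concatMap edgesOf ws
      ; route⊆H = All.concat⁺ (All.map⁺ {xs = ws}
          (All.tabulate λ {w} _ → All.tabulate λ e′∈w → proj₁ (E⊆ (edgesOf⊆ w e′∈w))))
      ; cost = cost
      ; cut = λ _ S S⁺ S⊆S⁺ cr d<k → subst (K ≤_) (sym (*-identityˡ _))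
          (cutCount (k ∸ 1) ∣ S⁺ ─ S ∣ _ (∸-monoˡ-≤ 1 d<k)
            (subst₂ (λ a b → a ≤ ∣ S⁺ ─ S ∣ + b) length-ws (sym (sumBy-concatMap _ edgesOf ws))
              (Biset.interiorDisjoint-cutBound S S⁺ S⊆S⁺ (Biset.crosses-ends S S⁺ S⊆S⁺ e cr) ws disjoint)))
      }
      where
      cost : 1 * sumBy wt (concatMap edgesOf ws) ≤ K * (4 * t * wt e)
      cost = begin
        1 * sumBy wt (concatMap edgesOf ws)        ≡⟨ trans (*-identityˡ _) (sumBy-concatMap wt edgesOf ws) ⟩
        sumBy (sumBy wt ∘ edgesOf) ws              ≤⟨ sumBy-mono ws (λ w∈ws → shortWalkWeight s _ (All.lookup short w∈ws)
                                                        (λ e′∈E → proj₂ (E⊆ e′∈E)) e∈bucket) ⟩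
        sumBy (λ _ → suc (suc (2 * s)) * wt e) ws ≡⟨ sumBy-const _ ws ⟩
        length ws * (suc (suc (2 * s)) * wt e)     ≡⟨ cong (_* (suc (suc (2 * s)) * wt e)) length-ws ⟩
        suc (2 * (k ∸ 1)) * (suc (suc (2 * s)) * wt e) ≤⟨ routeCost (k ∸ 1) s (wt e) ⟩
        K * (4 * t * wt e)                         ∎
        where open ≤-Reasoning

  reroute : ∀ e → Reroute e
  reroute e with any? (e ≟ₑ_) (output H)
  ... | yes e∈H = kept e∈H
  ... | no e∉H with any? (e ≟ₑ_) G
  ...   | no e∉G = record { mult = 0 ; route = [] ; route⊆H = [] ; cost = z≤n ; cut = λ e∈G → ⊥-elim (e∉G e∈G) }
  ...   | yes e∈G with rejected run [] e∈G e∉H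
  ...     | j , _ , e∈bucket , near , E⊆ = detour j e∈bucket near E⊆

  module _ (uniqueG : Unique G) (O : List (Edge n)) (O⊆G : ∀ {e} → e ∈ O → e ∈ G) (O-feasible : Satisfies r O) where

    private
      mult : Edge n → ℕ
      mult e = Reroute.mult (reroute e)

      route : Edge n → List (Edge n)
      route e = Reroute.route (reroute e)

      H-unique : Unique (output H)
      H-unique = output-unique run [] (All.universal (λ _ ()) G) uniqueG

      sumBy-load : ∀ (g : Edge n → ℕ) →
        sumBy (λ e′ → g e′ * sumBy (λ e → mult e * occurrences _≟ₑ_ e′ (route e)) O) (output H) ≡
        sumBy (λ e → mult e * sumBy g (route e)) O
      sumBy-load g = sumBy-weightedOccurrences _≟ₑ_ g mult route (output H) O H-unique (Reroute.route⊆H ∘ reroute)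

    load : Edge n → ℕ
    load e′ = sumBy (λ e → mult e * occurrences _≟ₑ_ e′ (route e)) O

    load-cost : sumBy (λ e′ → wt e′ * load e′) (output H) ≤ K * (4 * t * totalWeight O)
    load-cost = begin
      sumBy (λ e′ → wt e′ * load e′) (output H)     ≡⟨ sumBy-load wt ⟩
      sumBy (λ e → mult e * sumBy wt (route e)) O   ≤⟨ sumBy-mono O (λ {e} _ → Reroute.cost (reroute e)) ⟩
      sumBy (λ e → K * (4 * t * wt e)) O            ≡⟨ *-distribˡ-sumBy K _ O ⟨
      K * sumBy (λ e → 4 * t * wt e) O              ≡⟨ cong (K *_) (*-distribˡ-sumBy (4 * t) wt O) ⟨
      K * (4 * t * sumBy wt O)                      ≡⟨ cong (λ w → K * (4 * t * w)) (totalWeight≡sumBy O) ⟨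
      K * (4 * t * totalWeight O)                   ∎
      where open ≤-Reasoning

    load-cut : ∀ S S⁺ → (∀ x → lookup S x ≡ true → lookup S⁺ x ≡ true) →
      K * hBiset r S S⁺ ≤ sumBy (λ e′ → if crosses S S⁺ e′ then load e′ else 0) (output H)
    load-cut S S⁺ S⊆S⁺ with hBiset-attained r S S⁺
    ... | inj₁ h≡0 rewrite h≡0 | *-zeroʳ K = z≤n
    ... | inj₂ (u , v , Sv , S⁺u , h≡) with r u v ≤? ∣ S⁺ ─ S ∣
    ...   | yes r≤d rewrite h≡ | m≤n⇒m∸n≡0 r≤d | *-zeroʳ K = z≤n
    ...   | no r≰d = begin
      K * hBiset r S S⁺                                       ≡⟨ cong (K *_) h≡ ⟩
      K * (r u v ∸ d)                                         ≤⟨ *-monoʳ-≤ K (m≤n+o⇒m∸n≤o (r u v) d O-cut) ⟩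
      K * countᵇ cr O                                         ≡⟨ *-distribˡ-sumBy K (𝟙 cr) O ⟩
      sumBy (λ e → K * (𝟙 cr) e) O                            ≤⟨ sumBy-mono O per-edge ⟩
      sumBy (λ e → mult e * countᵇ cr (route e)) O            ≡⟨ sumBy-load (𝟙 cr) ⟨
      sumBy (λ e′ → 𝟙 cr e′ * load e′) (output H)           ≡⟨ sumBy-cong (output H) (λ e′ → if-* (cr e′) (load e′)) ⟩
      sumBy (λ e′ → if cr e′ then load e′ else 0) (output H)  ∎
      where
      open ≤-Reasoning
      d = ∣ S⁺ ─ S ∣
      cr = crosses S S⁺
      𝟙 : (Edge n → Bool) → Edge n → ℕ
      𝟙 p e = if p e then 1 else 0
      if-* : ∀ b z → (if b then 1 else 0) * z ≡ (if b then z else 0)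
      if-* true z = +-identityʳ z
      if-* false z = refl
      u≢v : u ≢ v
      u≢v refl = Biset.S∩∉S⁺ S S⁺ S⊆S⁺ Sv S⁺u
      O-cut : r u v ≤ d + countᵇ cr O
      O-cut = Biset.disjointPaths-cutBound S S⁺ S⊆S⁺ S⁺u Sv (O-feasible u v u≢v)
      d<k : d < k
      d<k = <-≤-trans (≰⇒> r≰d) (r≤maxReq r u v)
      per-edge : ∀ {e} → e ∈ O → K * (𝟙 cr) e ≤ mult e * countᵇ cr (route e)
      per-edge {e} e∈O with cr e in cr-e
      ... | true = subst (_≤ mult e * countᵇ cr (route e)) (sym (*-identityʳ K))
        (Reroute.cut (reroute e) (O⊆G e∈O) S S⁺ S⊆S⁺ cr-e d<k)
      ... | false = subst (_≤ mult e * countᵇ cr (route e)) (sym (*-zeroʳ K)) z≤n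

    open Scaling K renaming (1/K to κ)

    lpSolution : Edge n → ℚ
    lpSolution e = ℕtoℚ (load e) ℚ.* κ

    private
      lpSolution-if : ∀ (p : Edge n → Bool) e →
        (if p e then lpSolution e else 0ℚ) ≡ ℕtoℚ (if p e then load e else 0) ℚ.* κ
      lpSolution-if p e = if-ℕtoℚ-* (p e) (load e) κ

      sumℚ-if : ∀ (p : Edge n → Bool) → sumℚ (λ e → if p e then lpSolution e else 0ℚ) (output H) ≡
        ℕtoℚ (sumBy (λ e → if p e then load e else 0) (output H)) ℚ.* κ
      sumℚ-if p = sumℚ-ℕtoℚ-* (λ e → if p e then lpSolution e else 0ℚ) (λ e → if p e then load e else 0) κ
        (λ e → lpSolution-if p e) (output H)

    lpSolution-feasible : LPFeasible r (output H) lpSolution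
    lpSolution-feasible = All.universal nonNegative (output H) , λ S S⁺ S⊆S⁺ → begin
      ℕtoℚ (hBiset r S S⁺)                  ≡⟨ ℕtoℚ-*-cancel (hBiset r S S⁺) ⟨
      ℕtoℚ (K * hBiset r S S⁺) ℚ.* κ        ≤⟨ ℕtoℚ-*-mono-≤ (load-cut S S⁺ (λ x Sx → []=⇒lookup (S⊆S⁺ (lookup⇒[]= x S Sx)))) ⟩
      ℕtoℚ (sumBy (λ e → if crosses S S⁺ e then load e else 0) (output H)) ℚ.* κ
                                            ≡⟨ sumℚ-if (crosses S S⁺) ⟨
      sumℚ (λ e → if crosses S S⁺ e then lpSolution e else 0ℚ) (output H) ∎
      where
      open ℚ.≤-Reasoning
      nonNegative : ∀ e → 0ℚ ℚ.≤ lpSolution e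
      nonNegative e = subst (ℚ._≤ lpSolution e) (ℚ.*-zeroˡ κ) (ℕtoℚ-*-mono-≤ {0} {load e} z≤n)

    lpSolution-cost : lpCost (output H) lpSolution ℚ.≤ ℕtoℚ (4 * t) ℚ.* ℕtoℚ (totalWeight O)
    lpSolution-cost = begin
      lpCost (output H) lpSolution                          ≡⟨ sumℚ-ℕtoℚ-* _ _ κ pointwise (output H) ⟩
      ℕtoℚ (sumBy (λ e → wt e * load e) (output H)) ℚ.* κ  ≤⟨ ℕtoℚ-*-mono-≤ load-cost ⟩
      ℕtoℚ (K * (4 * t * totalWeight O)) ℚ.* κ              ≡⟨ ℕtoℚ-*-cancel (4 * t * totalWeight O) ⟩
      ℕtoℚ (4 * t * totalWeight O)                          ≡⟨ ℕtoℚ-* (4 * t) (totalWeight O) ⟩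
      ℕtoℚ (4 * t) ℚ.* ℕtoℚ (totalWeight O)                ∎
      where
      open ℚ.≤-Reasoning
      pointwise : ∀ e → ℕtoℚ (wt e) ℚ.* lpSolution e ≡ ℕtoℚ (wt e * load e) ℚ.* κ
      pointwise e =
        trans (sym (ℚ.*-assoc (ℕtoℚ (wt e)) (ℕtoℚ (load e)) κ)) (cong (ℚ._* κ) (sym (ℕtoℚ-* (wt e) (load e))))

subEdges⊆ : ∀ {n} (p : Edge n → Bool) G {e} → e ∈ subEdges p G → e ∈ G
subEdges⊆ p (e′ ∷ G) e∈ with p e′
subEdges⊆ p (e′ ∷ G) (here refl) | true = here refl
subEdges⊆ p (e′ ∷ G) (there e∈) | true = there (subEdges⊆ p G e∈)
... | false = there (subEdges⊆ p G e∈)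

theorem3p4 : (n W : ℕ) (G : List (Edge n)) (r : Req n) (t : ℕ) →
  SimpleGraph G → All (λ e → wt e ≤ W) G →
  Symmetric r → Satisfies r G → 1 ≤ t →
  (H : State n) →
  Run t ((2 * t ∸ 2) * (2 * maxReq r ∸ 1)) (eps t) [] G H →
  (keepE : Edge n → Bool) → Satisfies r (subEdges keepE G) →
  Σ (Edge n → ℚ) λ x →
    LPFeasible r (output H) x ×
    lpCost (output H) x ≤ℚ (ℕtoℚ (4 * t) *ℚ ℕtoℚ (totalWeight (subEdges keepE G)))
theorem3p4 n W G r zero _ _ _ _ () H run keepE O-feasible
theorem3p4 n W G r (suc s) (_ , simple) _ _ _ _ H run keepE O-feasible =
  lpSolution G r s run uniqueG O (subEdges⊆ keepE G) O-feasible ,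
  lpSolution-feasible G r s run uniqueG O (subEdges⊆ keepE G) O-feasible ,
  lpSolution-cost G r s run uniqueG O (subEdges⊆ keepE G) O-feasible
  where
  O = subEdges keepE G
  uniqueG : Unique G
  uniqueG = AllPairs.map (λ ¬same e≡e′ → ¬same (inj₁ (cong eu e≡e′ , cong ev e≡e′))) simple
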